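{- Let $r$ be a positive integer, let $s,t$ be integers with $0\le s,t\le r-1$, and let $h$ be a positive integer with $r<\phi^h$. Then there exists a Hofstadter G pair $(u,v)$ with $u\equiv s\pmod r$ and $v\equiv t\pmod r$ such that the Zeckendorf representation of $v$ has length at most $2h$.
   Context: $F_0=0$, $F_1=1$, $F_i=F_{i-1}+F_{i-2}$ are the Fibonacci numbers and $\phi=(1+\sqrt5)/2$. For a bit string $\beta=\langle\beta_1\ldots\beta_\ell\rangle$, $\mathrm{FibSum}(\beta)=\sum_{i=1}^\ell\beta_iF_{i+1}$. The Zeckendorf representation of a positive integer $m$ is the unique bit string $\beta$ with $\mathrm{FibSum}(\beta)=m$, $\beta_\ell=1$, and no two consecutive 1s; its length is $\ell$. Hofstadter's G function is $G(x)=\lfloor\phi^{ -1}(x+1)\rfloor$ for integers $x\ge0$. A Hofstadter G pair is a pair $(u,v)$ of positive integers with $u=G(v)$. -}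

module Defs where

open import Data.Nat as ℕ using (ℕ; zero; suc)
open import Data.Integer as ℤ using (ℤ; +_)
open import Data.Bool using (Bool; true; false)
open import Data.List using (List; []; _∷_; last)
open import Data.Maybe using (just)
open import Data.Product using (_×_)
open import Data.Sum using (_⊎_)
open import Data.Unit using (⊤)
open import Data.Empty using (⊥)
open import Relation.Nullary using (¬_)
open import Relation.Binary.PropositionalEquality using (_≡_)

F : ℕ → ℕ
F 0 = 0
F 1 = 1
F (suc (suc i)) = F (suc i) ℕ.+ F i

-- Exact real arithmetic in ℤ[φ], φ = (1+√5)/2.
-- A value  mk a b  denotes the real number  a + b·φ.

record ℤφ : Set where
  constructor mk
  field
    re : ℤ
    ph : ℤ

open ℤφ public

-- the real number x + y·√5 is strictly positive (exact decision by squaring)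
Pos√5 : ℤ → ℤ → Set
Pos√5 x y =
    (+ 0 ℤ.< x × + 0 ℤ.≤ y)
  ⊎ (+ 0 ℤ.≤ x × + 0 ℤ.< y)
  ⊎ (+ 0 ℤ.< x × y ℤ.< + 0 × + 5 ℤ.* (y ℤ.* y) ℤ.< x ℤ.* x)
  ⊎ (x ℤ.< + 0 × + 0 ℤ.< y × x ℤ.* x ℤ.< + 5 ℤ.* (y ℤ.* y))

-- a + bφ = (2a + b + b√5)/2 > 0
Pos : ℤφ → Set
Pos (mk a b) = Pos√5 (a ℤ.+ a ℤ.+ b) b

infixl 6 _+φ_ _-φ_
infixl 7 _*φ_
infix 4 _<φ_ _≤φ_
infixr 8 _^φ_

_+φ_ : ℤφ → ℤφ → ℤφ
mk a b +φ mk c d = mk (a ℤ.+ c) (b ℤ.+ d)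

_-φ_ : ℤφ → ℤφ → ℤφ
mk a b -φ mk c d = mk (a ℤ.- c) (b ℤ.- d)

-- (a + bφ)(c + dφ) = (ac + bd) + (ad + bc + bd)φ   using φ² = φ + 1
_*φ_ : ℤφ → ℤφ → ℤφ
mk a b *φ mk c d = mk (a ℤ.* c ℤ.+ b ℤ.* d) (a ℤ.* d ℤ.+ b ℤ.* c ℤ.+ b ℤ.* d)

ι : ℕ → ℤφ
ι n = mk (+ n) (+ 0)

φ : ℤφ
φ = mk (+ 0) (+ 1)

_^φ_ : ℤφ → ℕ → ℤφ
x ^φ zero = ι 1
x ^φ suc n = x *φ (x ^φ n)

_<φ_ : ℤφ → ℤφ → Set
x <φ y = Pos (y -φ x)

_≤φ_ : ℤφ → ℤφ → Set
x ≤φ y = ¬ (y <φ x)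

-- Hofstadter G: G(x) = ⌊φ⁻¹(x+1)⌋.
-- "u = G(v)"  iff  u ≤ (v+1)/φ < u+1  iff  u·φ ≤ v+1 < (u+1)·φ   (φ > 0)

IsG : ℕ → ℕ → Set
IsG u v = (ι u *φ φ ≤φ ι (suc v)) × (ι (suc v) <φ ι (suc u) *φ φ)

HofstadterGPair : ℕ → ℕ → Set
HofstadterGPair u v = (0 ℕ.< u) × (0 ℕ.< v) × IsG u v

-- Zeckendorf representations.  A bit string ⟨β₁…β_ℓ⟩ is a List Bool,
-- head = β₁.  FibSum β = Σ_i β_i F_{i+1}.

fibSumFrom : ℕ → List Bool → ℕ
fibSumFrom k [] = 0
fibSumFrom k (true ∷ bs) = F k ℕ.+ fibSumFrom (suc k) bs
fibSumFrom k (false ∷ bs) = fibSumFrom (suc k) bs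

FibSum : List Bool → ℕ
FibSum β = fibSumFrom 2 β

NoConsecutiveOnes : List Bool → Set
NoConsecutiveOnes [] = ⊤
NoConsecutiveOnes (_ ∷ []) = ⊤
NoConsecutiveOnes (true ∷ true ∷ _) = ⊥
NoConsecutiveOnes (_ ∷ b ∷ bs) = NoConsecutiveOnes (b ∷ bs)

IsZeckendorf : List Bool → ℕ → Set
IsZeckendorf β m = (FibSum β ≡ m) × (last β ≡ just true) × NoConsecutiveOnes β

-- A pair (u, v) is a Hofstadter G pair iff the error v − uφ lies in the window (−1, φ⁻¹).
-- Moving (u, v) by r (F h, F (h+1)) or by r (F (h+1), F (h+2)) keeps u and v in their
-- residue classes mod r and shifts the error by r ψʰ or r ψʰ⁺¹ (ψ = 1 − φ). These have
-- opposite signs and differ by r φ⁻ʰ⁺¹ < φ, the width of the window, because r < φʰ; so one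
-- of the two moves stays in the window, and v can be lowered until v ≤ r F (h+2) < F (2h+2).
-- A first point in the required residue class comes from inverting, mod r, the unimodular
-- matrix with columns (F (h+1), F (h+2)) and (F (h+2), F (h+3)). Finally every number below
-- F (2h+2) has a Zeckendorf representation of length at most 2h.
-- The real numbers involved live in ℤ[φ], where a + bφ > 0 iff φⁿ(a + bφ) has positive
-- coordinates for some n; this form of positivity is closed under sums and products, and it
-- agrees with the exact test Pos used in the statement.
module Submission where

open import Defs hiding (_-φ_)
open import Data.Nat as ℕ using (ℕ; zero; suc; z≤n; s≤s; NonZero; _∸_)
import Data.Nat.Properties as ℕP
open import Data.Product using (Σ; ∃; _×_; _,_; proj₁; proj₂)
open import Data.Sum as Sum using (_⊎_; inj₁; inj₂)
open import Data.Empty using (⊥; ⊥-elim)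
open import Relation.Binary.PropositionalEquality
open import Relation.Nullary using (¬_; yes; no)

module ℤ[φ] where

  import Data.Integer as ℤ
  open import Data.Integer
    using (ℤ; ∣_∣; _⊖_; +_; +[1+_]; -[1+_]; -_; _+_; _-_; _*_; _<_; _≤_; 0ℤ; 1ℤ; +<+; +≤+)
  import Data.Integer.Properties as ℤP
  open import Data.Integer.Tactic.RingSolver using (solve-∀; solve)
  open import Data.List using ([]; _∷_)
  open import Data.Maybe using (Maybe; just; nothing)
  open import Relation.Binary.Definitions using (tri<; tri≈; tri>)
  open import Algebra.Bundles using (CommutativeRing)
  import Tactic.RingSolver as RingSolver
  import Tactic.RingSolver.Core.AlmostCommutativeRing as ACR

  mk-≡ : ∀ {a b c d} → a ≡ c → b ≡ d → mk a b ≡ mk c d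
  mk-≡ = cong₂ mk

  fromℤ : ℤ → ℤφ
  fromℤ a = mk a 0ℤ

  0φ 1φ : ℤφ
  0φ = fromℤ 0ℤ
  1φ = fromℤ 1ℤ

  negφ : ℤφ → ℤφ
  negφ (mk a b) = mk (- a) (- b)

  private
    *-assoc-re : ∀ a b c d e f →
      (a * c + b * d) * e + (a * d + b * c + b * d) * f
        ≡ a * (c * e + d * f) + b * (c * f + d * e + d * f)
    *-assoc-re = solve-∀

    *-assoc-ph : ∀ a b c d e f →
      (a * c + b * d) * f + (a * d + b * c + b * d) * e + (a * d + b * c + b * d) * f
        ≡ a * (c * f + d * e + d * f) + b * (c * e + d * f) + b * (c * f + d * e + d * f)
    *-assoc-ph = solve-∀

    *-distribʳ-re : ∀ a b c d e f →
      (c + e) * a + (d + f) * b ≡ (c * a + d * b) + (e * a + f * b)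
    *-distribʳ-re = solve-∀

    *-distribʳ-ph : ∀ a b c d e f →
      (c + e) * b + (d + f) * a + (d + f) * b ≡ (c * b + d * a + d * b) + (e * b + f * a + f * b)
    *-distribʳ-ph = solve-∀

    +φ-assoc : ∀ x y z → (x +φ y) +φ z ≡ x +φ (y +φ z)
    +φ-assoc (mk a b) (mk c d) (mk e f) = mk-≡ (ℤP.+-assoc a c e) (ℤP.+-assoc b d f)

    +φ-comm : ∀ x y → x +φ y ≡ y +φ x
    +φ-comm (mk a b) (mk c d) = mk-≡ (ℤP.+-comm a c) (ℤP.+-comm b d)

    +φ-identityˡ : ∀ x → 0φ +φ x ≡ x
    +φ-identityˡ (mk a b) = mk-≡ (ℤP.+-identityˡ a) (ℤP.+-identityˡ b)

    negφ-inverseˡ : ∀ x → negφ x +φ x ≡ 0φ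
    negφ-inverseˡ (mk a b) = mk-≡ (ℤP.+-inverseˡ a) (ℤP.+-inverseˡ b)

    *φ-comm : ∀ x y → x *φ y ≡ y *φ x
    *φ-comm (mk a b) (mk c d) = mk-≡ (solve (a ∷ b ∷ c ∷ d ∷ [])) (solve (a ∷ b ∷ c ∷ d ∷ []))

    *φ-assoc : ∀ x y z → (x *φ y) *φ z ≡ x *φ (y *φ z)
    *φ-assoc (mk a b) (mk c d) (mk e f) = mk-≡ (*-assoc-re a b c d e f) (*-assoc-ph a b c d e f)

    *φ-identityˡ : ∀ x → 1φ *φ x ≡ x
    *φ-identityˡ (mk a b) = mk-≡ (solve (a ∷ b ∷ [])) (solve (a ∷ b ∷ []))

    *φ-distribʳ : ∀ x y z → (y +φ z) *φ x ≡ y *φ x +φ z *φ x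
    *φ-distribʳ (mk a b) (mk c d) (mk e f) = mk-≡ (*-distribʳ-re a b c d e f) (*-distribʳ-ph a b c d e f)

    *φ-distribˡ : ∀ x y z → x *φ (y +φ z) ≡ x *φ y +φ x *φ z
    *φ-distribˡ x y z = begin
      x *φ (y +φ z)         ≡⟨ *φ-comm x (y +φ z) ⟩
      (y +φ z) *φ x         ≡⟨ *φ-distribʳ x y z ⟩
      y *φ x +φ z *φ x      ≡⟨ cong₂ _+φ_ (*φ-comm y x) (*φ-comm z x) ⟩
      x *φ y +φ x *φ z      ∎
      where open ≡-Reasoning

  ℤφ-commutativeRing : CommutativeRing _ _
  ℤφ-commutativeRing = record
    { Carrier = ℤφ ; _≈_ = _≡_ ; _+_ = _+φ_ ; _*_ = _*φ_ ; -_ = negφ ; 0# = 0φ ; 1# = 1φ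
    ; isCommutativeRing = record
      { isRing = record
        { +-isAbelianGroup = record
          { isGroup = record
            { isMonoid = record
              { isSemigroup = record
                { isMagma = record { isEquivalence = isEquivalence ; ∙-cong = cong₂ _+φ_ }
                ; assoc = +φ-assoc }
              ; identity = +φ-identityˡ , λ x → trans (+φ-comm x 0φ) (+φ-identityˡ x) }
            ; inverse = negφ-inverseˡ , λ x → trans (+φ-comm x (negφ x)) (negφ-inverseˡ x)
            ; ⁻¹-cong = cong negφ }
          ; comm = +φ-comm }
        ; *-cong = cong₂ _*φ_
        ; *-assoc = *φ-assoc
        ; *-identity = *φ-identityˡ , λ x → trans (*φ-comm x 1φ) (*φ-identityˡ x)
        ; distrib = *φ-distribˡ , *φ-distribʳ }
      ; *-comm = *φ-comm } }

  ℤφ-ring : ACR.AlmostCommutativeRing _ _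
  ℤφ-ring = ACR.fromCommutativeRing ℤφ-commutativeRing is-0φ?
    where
    is-0φ? : ∀ x → Maybe (0φ ≡ x)
    is-0φ? (mk (+ zero) (+ zero)) = just refl
    is-0φ? _ = nothing

  -- The subtraction of Defs, definitionally, but under the name the ring solver recognises.
  open ACR.AlmostCommutativeRing ℤφ-ring public using () renaming (_-_ to infixl 6 _-φ_)

  φ*-mk : ∀ a b → φ *φ mk a b ≡ mk b (a + b)
  φ*-mk a b = mk-≡ (solve (a ∷ b ∷ [])) (solve (a ∷ b ∷ []))

  fromℤ-* : ∀ a b → fromℤ (a * b) ≡ fromℤ a *φ fromℤ b
  fromℤ-* a b = mk-≡ (sym (ℤP.+-identityʳ (a * b))) (zero-ph a b)
    where
    zero-ph : ∀ a b → 0ℤ ≡ a * 0ℤ + 0ℤ * b + 0ℤ * 0ℤ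
    zero-ph = solve-∀

  φ⁻¹ ψ : ℤφ
  φ⁻¹ = φ -φ 1φ
  ψ = 1φ -φ φ

  ^φ-+ : ∀ x m n → x ^φ (m ℕ.+ n) ≡ x ^φ m *φ x ^φ n
  ^φ-+ x zero n = sym (*φ-identityˡ (x ^φ n))
  ^φ-+ x (suc m) n = trans (cong (x *φ_) (^φ-+ x m n)) (sym (*φ-assoc x (x ^φ m) (x ^φ n)))

  φ⁻¹^*φ^ : ∀ n → φ⁻¹ ^φ n *φ φ ^φ n ≡ 1φ
  φ⁻¹^*φ^ zero = refl
  φ⁻¹^*φ^ (suc n) = begin
    (φ⁻¹ *φ φ⁻¹ ^φ n) *φ (φ *φ φ ^φ n)  ≡⟨ interchange φ⁻¹ (φ⁻¹ ^φ n) φ (φ ^φ n) ⟩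
    (φ⁻¹ *φ φ) *φ (φ⁻¹ ^φ n *φ φ ^φ n)  ≡⟨ cong ((φ⁻¹ *φ φ) *φ_) (φ⁻¹^*φ^ n) ⟩
    (φ⁻¹ *φ φ) *φ 1φ                    ≡⟨⟩
    1φ                                  ∎
    where
    open ≡-Reasoning
    interchange : ∀ e E f P → (e *φ E) *φ (f *φ P) ≡ (e *φ f) *φ (E *φ P)
    interchange = RingSolver.solve-∀ ℤφ-ring

  𝔽 : ℕ → ℤ
  𝔽 n = + F n

  𝔽-suc-suc : ∀ n → 𝔽 (suc (suc n)) ≡ 𝔽 (suc n) + 𝔽 n
  𝔽-suc-suc n = ℤP.pos-+ (F (suc n)) (F n)

  F-mono : ∀ n → F n ℕ.≤ F (suc n)
  F-mono zero = z≤n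
  F-mono (suc n) = ℕP.m≤m+n (F (suc n)) (F n)

  F-pos : ∀ n → 0 ℕ.< F (suc n)
  F-pos zero = s≤s z≤n
  F-pos (suc n) = ℕP.≤-trans (F-pos n) (F-mono (suc n))

  φ^suc-mk : ∀ n → φ ^φ suc n ≡ mk (𝔽 n) (𝔽 (suc n))
  φ^suc-mk zero = refl
  φ^suc-mk (suc n) = begin
    φ *φ φ ^φ suc n                   ≡⟨ cong (φ *φ_) (φ^suc-mk n) ⟩
    φ *φ mk (𝔽 n) (𝔽 (suc n))         ≡⟨ φ*-mk (𝔽 n) (𝔽 (suc n)) ⟩
    mk (𝔽 (suc n)) (𝔽 n + 𝔽 (suc n))
      ≡⟨ cong (mk (𝔽 (suc n))) (trans (ℤP.+-comm (𝔽 n) (𝔽 (suc n))) (sym (𝔽-suc-suc n))) ⟩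
    mk (𝔽 (suc n)) (𝔽 (suc (suc n)))  ∎
    where open ≡-Reasoning

  ψ*-mk : ∀ a b → ψ *φ mk a b ≡ mk (a - b) (- a)
  ψ*-mk a b = mk-≡ (solve (a ∷ b ∷ [])) (solve (a ∷ b ∷ []))

  ψ^-mk : ∀ n → ψ ^φ n ≡ mk (𝔽 (suc n)) (- 𝔽 n)
  ψ^-mk zero = refl
  ψ^-mk (suc n) = begin
    ψ *φ ψ ^φ n                           ≡⟨ cong (ψ *φ_) (ψ^-mk n) ⟩
    ψ *φ mk (𝔽 (suc n)) (- 𝔽 n)           ≡⟨ ψ*-mk (𝔽 (suc n)) (- 𝔽 n) ⟩
    mk (𝔽 (suc n) - - 𝔽 n) (- 𝔽 (suc n))  ≡⟨ cong (λ a → mk a (- 𝔽 (suc n))) (sym F₂≡) ⟩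
    mk (𝔽 (suc (suc n))) (- 𝔽 (suc n))   ∎
    where
    open ≡-Reasoning
    F₂≡ : 𝔽 (suc (suc n)) ≡ 𝔽 (suc n) - - 𝔽 n
    F₂≡ = trans (𝔽-suc-suc n) (cong (_+_ (𝔽 (suc n))) (sym (ℤP.neg-involutive (𝔽 n))))

  ψ^-𝔽 : ∀ k → ψ ^φ k ≡ fromℤ (𝔽 (suc k)) -φ fromℤ (𝔽 k) *φ φ
  ψ^-𝔽 k = trans (ψ^-mk k) (sym (mk-≡ (re-id (𝔽 k) (𝔽 (suc k))) (ph-id (𝔽 k))))
    where
    re-id : ∀ u v → v - (u * 0ℤ + 0ℤ * 1ℤ) ≡ v
    re-id = solve-∀
    ph-id : ∀ u → 0ℤ - (u * 1ℤ + 0ℤ * 0ℤ + 0ℤ * 1ℤ) ≡ - u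
    ph-id = solve-∀

  cassini : ℕ → ℤ
  cassini n = 𝔽 (suc n) * 𝔽 (suc n) - 𝔽 (suc n) * 𝔽 n - 𝔽 n * 𝔽 n

  cassini-suc : ∀ n → cassini (suc n) ≡ - cassini n
  cassini-suc n rewrite 𝔽-suc-suc n = alternates (𝔽 (suc n)) (𝔽 n)
    where
    alternates : ∀ p q → (p + q) * (p + q) - (p + q) * p - p * p ≡ - (p * p - p * q - q * q)
    alternates = solve-∀

  cassini-±1 : ∀ n → (cassini n ≡ 1ℤ × cassini (suc n) ≡ - 1ℤ)
                   ⊎ (cassini n ≡ - 1ℤ × cassini (suc n) ≡ 1ℤ)
  cassini-±1 zero = inj₁ (refl , refl)
  cassini-±1 (suc n) with cassini-±1 n
  ... | inj₁ (_ , c) = inj₂ (c , trans (cassini-suc (suc n)) (cong -_ c))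
  ... | inj₂ (_ , c) = inj₁ (c , trans (cassini-suc (suc n)) (cong -_ c))

  cassini² : ∀ n → cassini n * cassini n ≡ 1ℤ
  cassini² n with cassini-±1 n
  ... | inj₁ (c≡1 , _) = cong (λ x → x * x) c≡1
  ... | inj₂ (c≡-1 , _) = cong (λ x → x * x) c≡-1

  det-𝔽² : ∀ h → (𝔽 (suc h) * 𝔽 (suc (suc (suc h))) - 𝔽 (suc (suc h)) * 𝔽 (suc (suc h)))
               * (𝔽 (suc h) * 𝔽 (suc (suc (suc h))) - 𝔽 (suc (suc h)) * 𝔽 (suc (suc h))) ≡ 1ℤ
  det-𝔽² h = begin
    (p * 𝔽 (suc (suc (suc h))) - q * q) * (p * 𝔽 (suc (suc (suc h))) - q * q)
      ≡⟨ cong (λ f → (p * f - q * q) * (p * f - q * q)) (𝔽-suc-suc (suc h)) ⟩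
    (p * (q + p) - q * q) * (p * (q + p) - q * q)  ≡⟨ negated p q ⟩
    cassini (suc h) * cassini (suc h)              ≡⟨ cassini² (suc h) ⟩
    1ℤ                                             ∎
    where
    open ≡-Reasoning
    p = 𝔽 (suc h)
    q = 𝔽 (suc (suc h))
    negated : ∀ p q → (p * (q + p) - q * q) * (p * (q + p) - q * q)
                    ≡ (q * q - q * p - p * p) * (q * q - q * p - p * p)
    negated = solve-∀

  ψ^-sign : ∀ n → (ψ ^φ n ≡ φ⁻¹ ^φ n × ψ ^φ suc n ≡ negφ (φ⁻¹ ^φ suc n))
                ⊎ (ψ ^φ n ≡ negφ (φ⁻¹ ^φ n) × ψ ^φ suc n ≡ φ⁻¹ ^φ suc n)
  ψ^-sign zero = inj₁ (refl , refl)
  ψ^-sign (suc n) with ψ^-sign n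
  ... | inj₁ (_ , e) = inj₂ (e , trans (cong (ψ *φ_) e) (neg*neg φ (φ⁻¹ ^φ suc n)))
    where
    neg*neg : ∀ p y → (1φ -φ p) *φ negφ y ≡ (p -φ 1φ) *φ y
    neg*neg = RingSolver.solve-∀ ℤφ-ring
  ... | inj₂ (_ , e) = inj₁ (e , trans (cong (ψ *φ_) e) (neg* φ (φ⁻¹ ^φ suc n)))
    where
    neg* : ∀ p y → (1φ -φ p) *φ y ≡ negφ ((p -φ 1φ) *φ y)
    neg* = RingSolver.solve-∀ ℤφ-ring

  φ^suc-suc : ∀ n → φ ^φ suc (suc n) ≡ φ ^φ suc n +φ φ ^φ n
  φ^suc-suc n = trans (sym (*φ-assoc φ φ (φ ^φ n))) (distribute φ (φ ^φ n))
    where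
    distribute : ∀ f P → (f +φ 1φ) *φ P ≡ f *φ P +φ P
    distribute = RingSolver.solve-∀ ℤφ-ring

  ψ^suc-suc : ∀ n → ψ ^φ suc (suc n) ≡ φ⁻¹ *φ (φ⁻¹ *φ ψ ^φ n)
  ψ^suc-suc n = square φ (ψ ^φ n)
    where
    square : ∀ f x → (1φ -φ f) *φ ((1φ -φ f) *φ x) ≡ (f -φ 1φ) *φ ((f -φ 1φ) *φ x)
    square = RingSolver.solve-∀ ℤφ-ring

  𝔽-+ : ∀ b a → fromℤ (𝔽 (b ℕ.+ a)) ≡ fromℤ (𝔽 a) *φ φ ^φ b +φ fromℤ (𝔽 b) *φ ψ ^φ a
  𝔽-+ zero a = unit (fromℤ (𝔽 a)) (ψ ^φ a)
    where
    unit : ∀ x y → x ≡ x *φ 1φ +φ 0φ *φ y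
    unit = RingSolver.solve-∀ ℤφ-ring
  𝔽-+ (suc zero) a =
    trans (one (fromℤ (𝔽 a)) (fromℤ (𝔽 (suc a))) φ)
          (cong (λ y → fromℤ (𝔽 a) *φ (φ *φ 1φ) +φ 1φ *φ y) (sym (ψ^-𝔽 a)))
    where
    one : ∀ U V f → V ≡ U *φ (f *φ 1φ) +φ 1φ *φ (V -φ U *φ f)
    one = RingSolver.solve-∀ ℤφ-ring
  𝔽-+ (suc (suc b)) a = begin
    fromℤ (𝔽 (suc (suc (b ℕ.+ a))))
      ≡⟨ cong fromℤ (𝔽-suc-suc (b ℕ.+ a)) ⟩
    fromℤ (𝔽 (suc b ℕ.+ a)) +φ fromℤ (𝔽 (b ℕ.+ a))
      ≡⟨ cong₂ _+φ_ (𝔽-+ (suc b) a) (𝔽-+ b a) ⟩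
    (Fa *φ φ ^φ suc b +φ F′ *φ ψ ^φ a) +φ (Fa *φ φ ^φ b +φ F″ *φ ψ ^φ a)
      ≡⟨ collect Fa (φ ^φ suc b) (φ ^φ b) F′ F″ (ψ ^φ a) ⟩
    Fa *φ (φ ^φ suc b +φ φ ^φ b) +φ (F′ +φ F″) *φ ψ ^φ a
      ≡⟨ cong₂ (λ P G → Fa *φ P +φ fromℤ G *φ ψ ^φ a) (sym (φ^suc-suc b)) (sym (𝔽-suc-suc b)) ⟩
    Fa *φ φ ^φ suc (suc b) +φ fromℤ (𝔽 (suc (suc b))) *φ ψ ^φ a ∎
    where
    open ≡-Reasoning
    Fa = fromℤ (𝔽 a)
    F′ = fromℤ (𝔽 (suc b))
    F″ = fromℤ (𝔽 b)
    collect : ∀ F P P′ G G′ Q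
            → (F *φ P +φ G *φ Q) +φ (F *φ P′ +φ G′ *φ Q) ≡ F *φ (P +φ P′) +φ (G +φ G′) *φ Q
    collect = RingSolver.solve-∀ ℤφ-ring

  𝔽-doubled : ∀ h → fromℤ (𝔽 (h ℕ.+ suc (suc h)))
                  ≡ fromℤ (𝔽 (suc (suc h))) *φ φ ^φ h +φ fromℤ (𝔽 h) *φ (φ⁻¹ *φ (φ⁻¹ *φ ψ ^φ h))
  𝔽-doubled h = trans (𝔽-+ h (suc (suc h)))
    (cong (λ q → fromℤ (𝔽 (suc (suc h))) *φ φ ^φ h +φ fromℤ (𝔽 h) *φ q) (ψ^suc-suc h))

  lucas : ℕ → ℤ
  lucas zero = + 2
  lucas (suc n) = 𝔽 n + 𝔽 (suc (suc n))

  φ^+ψ^ : ∀ n → φ ^φ n +φ ψ ^φ n ≡ fromℤ (lucas n)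
  φ^+ψ^ zero = refl
  φ^+ψ^ (suc n) = begin
    φ ^φ suc n +φ ψ ^φ suc n
      ≡⟨ cong₂ _+φ_ (φ^suc-mk n) (ψ^-mk (suc n)) ⟩
    mk (𝔽 n + 𝔽 (suc (suc n))) (𝔽 (suc n) - 𝔽 (suc n))
      ≡⟨ cong (mk (lucas (suc n))) (ℤP.+-inverseʳ (𝔽 (suc n))) ⟩
    fromℤ (lucas (suc n)) ∎
    where open ≡-Reasoning

  *-pos : ∀ {a b} → 0ℤ < a → 0ℤ < b → 0ℤ < a * b
  *-pos (+<+ (s≤s _)) (+<+ (s≤s _)) = +<+ (s≤s z≤n)

  *-nonneg : ∀ {a b} → 0ℤ ≤ a → 0ℤ ≤ b → 0ℤ ≤ a * b
  *-nonneg {+ m} {+ n} _ _ = subst (0ℤ ≤_) (ℤP.pos-* m n) (+≤+ z≤n)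

  square-pos : ∀ {b} → b < 0ℤ → 0ℤ < b * b
  square-pos {b} b<0 = subst (0ℤ <_) (neg*neg b) (*-pos (ℤP.neg-mono-< b<0) (ℤP.neg-mono-< b<0))
    where
    neg*neg : ∀ b → (- b) * (- b) ≡ b * b
    neg*neg = solve-∀

  *-cancel-pos : ∀ {k x} → 0ℤ ≤ k → 0ℤ < k * x → 0ℤ < x
  *-cancel-pos {k} {x} k≥0 h =
    ℤP.*-cancelˡ-<-nonNeg k {{ℤ.nonNegative k≥0}} (subst (_< k * x) (sym (ℤP.*-zeroʳ k)) h)

  0<-⇒< : ∀ {i j} → 0ℤ < j - i → i < j
  0<-⇒< {i} {j} h = subst₂ _<_ (ℤP.+-identityʳ i) (cancel i j) (ℤP.+-monoʳ-< i h)
    where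
    cancel : ∀ i j → i + (j - i) ≡ j
    cancel = solve-∀

  Quadrant : ℤφ → Set
  Quadrant x = 0ℤ < re x × 0ℤ < ph x

  Quadrant-+ : ∀ {x y} → Quadrant x → Quadrant y → Quadrant (x +φ y)
  Quadrant-+ (a , b) (c , d) = ℤP.+-mono-< a c , ℤP.+-mono-< b d

  Quadrant-* : ∀ {x y} → Quadrant x → Quadrant y → Quadrant (x *φ y)
  Quadrant-* (a , b) (c , d) =
    ℤP.+-mono-< (*-pos a c) (*-pos b d) , ℤP.+-mono-< (ℤP.+-mono-< (*-pos a d) (*-pos b c)) (*-pos b d)

  Quadrant-φ^* : ∀ k {x} → Quadrant x → Quadrant (φ ^φ k *φ x)
  Quadrant-φ^* zero {x} q = subst Quadrant (sym (*φ-identityˡ x)) q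
  Quadrant-φ^* (suc k) {x} q = subst Quadrant (sym (*φ-assoc φ (φ ^φ k) x)) (φ*-Quadrant (Quadrant-φ^* k q))
    where
    φ*-Quadrant : ∀ {y} → Quadrant y → Quadrant (φ *φ y)
    φ*-Quadrant {mk a b} (a>0 , b>0) = subst Quadrant (sym (φ*-mk a b)) (b>0 , ℤP.+-mono-< a>0 b>0)

  Positive : ℤφ → Set
  Positive x = ∃ λ n → Quadrant (φ ^φ n *φ x)

  Positive-+ : ∀ {x y} → Positive x → Positive y → Positive (x +φ y)
  Positive-+ {x} {y} (m , qx) (n , qy) = m ℕ.+ n ,
    subst Quadrant (sym (trans (cong (_*φ (x +φ y)) (^φ-+ φ m n)) (exchange (φ ^φ m) (φ ^φ n) x y)))
          (Quadrant-+ (Quadrant-φ^* n qx) (Quadrant-φ^* m qy))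
    where
    exchange : ∀ p q x y → (p *φ q) *φ (x +φ y) ≡ q *φ (p *φ x) +φ p *φ (q *φ y)
    exchange = RingSolver.solve-∀ ℤφ-ring

  Positive-* : ∀ {x y} → Positive x → Positive y → Positive (x *φ y)
  Positive-* {x} {y} (m , qx) (n , qy) = m ℕ.+ n ,
    subst Quadrant (sym (trans (cong (_*φ (x *φ y)) (^φ-+ φ m n)) (exchange (φ ^φ m) (φ ^φ n) x y)))
          (Quadrant-* qx qy)
    where
    exchange : ∀ p q x y → (p *φ q) *φ (x *φ y) ≡ (p *φ x) *φ (q *φ y)
    exchange = RingSolver.solve-∀ ℤφ-ring

  Positive-φ*⁻¹ : ∀ {x} → Positive (φ *φ x) → Positive x
  Positive-φ*⁻¹ {x} (n , q) = suc n , subst Quadrant (regroup (φ ^φ n) φ x) q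
    where
    regroup : ∀ p f x → p *φ (f *φ x) ≡ (f *φ p) *φ x
    regroup = RingSolver.solve-∀ ℤφ-ring

  ¬Positive-0φ : ¬ Positive 0φ
  ¬Positive-0φ (n , q) = ℤP.<-irrefl refl (proj₁ (subst Quadrant (annihilates (φ ^φ n)) q))
    where
    annihilates : ∀ p → p *φ 0φ ≡ 0φ
    annihilates = RingSolver.solve-∀ ℤφ-ring

  Positive-asym : ∀ {x} → Positive x → Positive (negφ x) → ⊥
  Positive-asym {x} p q = ¬Positive-0φ (subst Positive (cancels x) (Positive-+ p q))
    where
    cancels : ∀ x → x +φ negφ x ≡ 0φ
    cancels = RingSolver.solve-∀ ℤφ-ring

  Positive-coords : ∀ {a b} → 0ℤ ≤ a → 0ℤ ≤ b → 0ℤ < a + b → Positive (mk a b)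
  Positive-coords {a} {b} _ b≥0 a+b>0 =
    2 , subst Quadrant (sym (φ²*-mk a b)) (a+b>0 , ℤP.+-mono-<-≤ a+b>0 b≥0)
    where
    φ²*-mk : ∀ a b → φ ^φ 2 *φ mk a b ≡ mk (a + b) (a + b + b)
    φ²*-mk a b = mk-≡ (solve (a ∷ b ∷ [])) (solve (a ∷ b ∷ []))

  Positive-ℤ : ∀ {a} → 0ℤ < a → Positive (fromℤ a)
  Positive-ℤ {a} a>0 =
    Positive-coords (ℤP.<⇒≤ a>0) ℤP.≤-refl (subst (0ℤ <_) (sym (ℤP.+-identityʳ a)) a>0)

  Positive-ℤ⁻¹ : ∀ {a} → Positive (fromℤ a) → 0ℤ < a
  Positive-ℤ⁻¹ {a} p with ℤP.<-cmp 0ℤ a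
  ... | tri< a>0 _ _ = a>0
  ... | tri≈ _ refl _ = ⊥-elim (¬Positive-0φ p)
  ... | tri> _ _ a<0 = ⊥-elim (Positive-asym p (Positive-ℤ (ℤP.neg-mono-< a<0)))

  Positive-^ : ∀ {x} n → Positive x → Positive (x ^φ n)
  Positive-^ zero _ = Positive-ℤ (+<+ (s≤s z≤n))
  Positive-^ (suc n) px = Positive-* px (Positive-^ n px)

  Positive-φ : Positive φ
  Positive-φ = 1 , +<+ (s≤s z≤n) , +<+ (s≤s z≤n)

  Positive-φ⁻¹ : Positive φ⁻¹
  Positive-φ⁻¹ = 3 , +<+ (s≤s z≤n) , +<+ (s≤s z≤n)

  Positive-φ⁻¹^ : ∀ n → Positive (φ⁻¹ ^φ n)
  Positive-φ⁻¹^ n = Positive-^ n Positive-φ⁻¹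

  Positive-1-φ⁻¹ : Positive (1φ -φ φ⁻¹)
  Positive-1-φ⁻¹ = 4 , +<+ (s≤s z≤n) , +<+ (s≤s z≤n)

  φ⁻¹^-decreasing : ∀ n → Positive (φ⁻¹ ^φ n -φ φ⁻¹ ^φ suc n)
  φ⁻¹^-decreasing n =
    subst Positive (factor (φ⁻¹ ^φ n) φ⁻¹) (Positive-* (Positive-φ⁻¹^ n) Positive-1-φ⁻¹)
    where
    factor : ∀ p e → p *φ (1φ -φ e) ≡ p -φ e *φ p
    factor = RingSolver.solve-∀ ℤφ-ring

  φ⁻¹^suc<1 : ∀ n → Positive (1φ -φ φ⁻¹ ^φ suc n)
  φ⁻¹^suc<1 zero = Positive-1-φ⁻¹
  φ⁻¹^suc<1 (suc n) = subst Positive (telescope (φ⁻¹ ^φ suc n) (φ⁻¹ ^φ suc (suc n)))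
    (Positive-+ (φ⁻¹^suc<1 n) (φ⁻¹^-decreasing (suc n)))
    where
    telescope : ∀ p q → (1φ -φ p) +φ (p -φ q) ≡ 1φ -φ q
    telescope = RingSolver.solve-∀ ℤφ-ring

  NonNegative : ℤφ → Set
  NonNegative x = Positive x ⊎ x ≡ 0φ

  Positive-+-NonNegative : ∀ {x y} → Positive x → NonNegative y → Positive (x +φ y)
  Positive-+-NonNegative px (inj₁ py) = Positive-+ px py
  Positive-+-NonNegative {x} px (inj₂ refl) = subst Positive (sym (+0φ x)) px
    where
    +0φ : ∀ x → x +φ 0φ ≡ x
    +0φ = RingSolver.solve-∀ ℤφ-ring

  NonNegative-+ : ∀ {x y} → NonNegative x → NonNegative y → NonNegative (x +φ y)
  NonNegative-+ (inj₁ px) ny = inj₁ (Positive-+-NonNegative px ny)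
  NonNegative-+ {y = y} (inj₂ refl) ny = subst NonNegative (sym (+φ-identityˡ y)) ny

  NonNegative-ℤ : ∀ {a} → 0ℤ ≤ a → NonNegative (fromℤ a)
  NonNegative-ℤ {+ zero} _ = inj₂ refl
  NonNegative-ℤ {+[1+ n ]} _ = inj₁ (Positive-ℤ {+[1+ n ]} (+<+ (s≤s z≤n)))

  NonNegative-ℤ* : ∀ {a x} → 0ℤ ≤ a → Positive x → NonNegative (fromℤ a *φ x)
  NonNegative-ℤ* {+ zero} {x} _ _ = inj₂ (0φ* x)
    where
    0φ* : ∀ x → 0φ *φ x ≡ 0φ
    0φ* = RingSolver.solve-∀ ℤφ-ring
  NonNegative-ℤ* {+[1+ n ]} _ px = inj₁ (Positive-* (Positive-ℤ {+[1+ n ]} (+<+ (s≤s z≤n))) px)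

  NonNegative-1-φ⁻¹^ : ∀ n → NonNegative (1φ -φ φ⁻¹ ^φ n)
  NonNegative-1-φ⁻¹^ zero = inj₂ refl
  NonNegative-1-φ⁻¹^ (suc n) = inj₁ (φ⁻¹^suc<1 n)

  Trichotomous : ℤφ → Set
  Trichotomous x = Positive x ⊎ x ≡ 0φ ⊎ Positive (negφ x)

  Trichotomous-φ*⁻¹ : ∀ {x} → Trichotomous (φ *φ x) → Trichotomous x
  Trichotomous-φ*⁻¹ (inj₁ p) = inj₁ (Positive-φ*⁻¹ p)
  Trichotomous-φ*⁻¹ {x} (inj₂ (inj₁ φx≡0)) = inj₂ (inj₁ (begin
    x                    ≡⟨ sym (*φ-identityˡ x) ⟩
    (φ⁻¹ *φ φ) *φ x      ≡⟨ *φ-assoc φ⁻¹ φ x ⟩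
    φ⁻¹ *φ (φ *φ x)      ≡⟨ cong (φ⁻¹ *φ_) φx≡0 ⟩
    φ⁻¹ *φ 0φ            ≡⟨ annihilates φ⁻¹ ⟩
    0φ                   ∎))
    where
    open ≡-Reasoning
    annihilates : ∀ p → p *φ 0φ ≡ 0φ
    annihilates = RingSolver.solve-∀ ℤφ-ring
  Trichotomous-φ*⁻¹ {x} (inj₂ (inj₂ p)) = inj₂ (inj₂ (Positive-φ*⁻¹ (subst Positive (neg-φ* φ x) p)))
    where
    neg-φ* : ∀ f x → negφ (f *φ x) ≡ f *φ negφ x
    neg-φ* = RingSolver.solve-∀ ℤφ-ring

  -- Euclid-like: if a + bφ has mixed signs, so does φ(a + bφ) = b + (a + b)φ unless it is
  -- settled outright, and its first coordinate is then smaller in absolute value.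
  trichotomy : ∀ x → Trichotomous x
  trichotomy (mk a b) = by-fuel ∣ a ∣ a b ℕP.≤-refl
    where
    0<+[1+_] : ∀ k → 0ℤ < +[1+ k ]
    0<+[1+ k ] = +<+ (s≤s z≤n)

    head-positive : ∀ {k m} → m ℕ.≤ k → Positive (mk +[1+ k ] (suc k ⊖ suc m))
    head-positive {k} m≤k = Positive-coords (+≤+ z≤n) c≥0 (ℤP.+-mono-<-≤ (0<+[1+ k ]) c≥0)
      where
      c≥0 = subst (0ℤ ≤_) (sym (ℤP.⊖-≥ (s≤s m≤k))) (+≤+ z≤n)

    by-fuel : ∀ n a b → ∣ a ∣ ℕ.≤ n → Trichotomous (mk a b)
    by-fuel _ (+ zero) (+ zero) _ = inj₂ (inj₁ refl)
    by-fuel _ (+ m) +[1+ k ] _ =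
      inj₁ (Positive-coords (+≤+ z≤n) (+≤+ z≤n) (ℤP.+-mono-≤-< (+≤+ z≤n) (0<+[1+ k ])))
    by-fuel _ +[1+ m ] (+ zero) _ = inj₁ (Positive-ℤ (0<+[1+ m ]))
    by-fuel _ (+ zero) -[1+ k ] _ = inj₂ (inj₂ (Positive-coords (+≤+ z≤n) (+≤+ z≤n) (0<+[1+ k ])))
    by-fuel _ -[1+ m ] (+ zero) _ = inj₂ (inj₂ (Positive-ℤ (0<+[1+ m ])))
    by-fuel _ -[1+ m ] -[1+ k ] _ =
      inj₂ (inj₂ (Positive-coords (+≤+ z≤n) (+≤+ z≤n) (ℤP.+-mono-< (0<+[1+ m ]) (0<+[1+ k ]))))
    by-fuel zero -[1+ m ] +[1+ k ] ()
    by-fuel (suc n) -[1+ m ] +[1+ k ] (s≤s m≤n) =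
      Trichotomous-φ*⁻¹ (subst Trichotomous (sym (φ*-mk -[1+ m ] +[1+ k ])) φx)
      where
      φx : Trichotomous (mk +[1+ k ] (-[1+ m ] + +[1+ k ]))
      φx with k ℕ.<? m
      ... | yes k<m = by-fuel n +[1+ k ] _ (ℕP.≤-trans k<m m≤n)
      ... | no k≮m = inj₁ (head-positive (ℕP.≮⇒≥ k≮m))
    by-fuel zero +[1+ m ] -[1+ k ] ()
    by-fuel (suc n) +[1+ m ] -[1+ k ] (s≤s m≤n) =
      Trichotomous-φ*⁻¹ (subst Trichotomous (sym (φ*-mk +[1+ m ] -[1+ k ])) φx)
      where
      φx : Trichotomous (mk -[1+ k ] (+[1+ m ] + -[1+ k ]))
      φx with k ℕ.<? m
      ... | yes k<m = by-fuel n -[1+ k ] _ (ℕP.≤-trans k<m m≤n)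
      ... | no k≮m = inj₂ (inj₂ (subst (λ c → Positive (mk +[1+ k ] c)) (ℤP.⊖-swap (suc k) (suc m))
                                       (head-positive (ℕP.≮⇒≥ k≮m))))

  fibComb : ℤ → ℤ → ℕ → ℤ
  fibComb a b n = a * 𝔽 n + b * 𝔽 (suc n)

  Positive⇒fibComb : ∀ {a b} → Positive (mk a b) → ∃ λ n → 0ℤ < fibComb a b n × 0ℤ < fibComb a b (suc n)
  Positive⇒fibComb {a} {b} (n , q) =
    n , subst (0ℤ <_) (re≡ a b (𝔽 n) (𝔽 (suc n))) (proj₁ q′) , subst (0ℤ <_) ph≡ (proj₂ q′)
    where
    regroup : ∀ p f x → (f *φ 1φ) *φ (p *φ x) ≡ (f *φ p) *φ x
    regroup = RingSolver.solve-∀ ℤφ-ring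
    q′ : Quadrant (mk (𝔽 n) (𝔽 (suc n)) *φ mk a b)
    q′ = subst Quadrant (trans (regroup (φ ^φ n) φ (mk a b)) (cong (_*φ mk a b) (φ^suc-mk n))) (Quadrant-φ^* 1 q)
    re≡ : ∀ a b q p → q * a + p * b ≡ a * q + b * p
    re≡ = solve-∀
    swap : ∀ a b q p → q * b + p * a + p * b ≡ a * p + b * (p + q)
    swap = solve-∀
    ph≡ : 𝔽 n * b + 𝔽 (suc n) * a + 𝔽 (suc n) * b ≡ fibComb a b (suc n)
    ph≡ = trans (swap a b (𝔽 n) (𝔽 (suc n))) (cong (λ f → a * 𝔽 (suc n) + b * f) (sym (𝔽-suc-suc n)))

  norm : ℤ → ℤ → ℤ
  norm a b = a * a + a * b - b * b

  -- With p = F (j+1), q = F j, S = aq + bp and C = cassini j = ±1: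
  --   q² norm a b = b² C + S (aq − b(p − q)),
  -- so the sign of the norm follows from S > 0 once the signs of a, b and C are known.
  norm-pos : ∀ {a b} j → 0ℤ < a → b < 0ℤ → 0ℤ < fibComb a b j → cassini j ≡ 1ℤ → 0ℤ < norm a b
  norm-pos {a} {b} j a>0 b<0 S>0 C≡1 = *-cancel-pos (*-nonneg q≥0 q≥0)
    (subst (0ℤ <_) (sym (identity a b p q))
      (subst (λ c → 0ℤ < b * b * c + S * T) (sym C≡1)
        (ℤP.+-mono-<-≤ (subst (0ℤ <_) (sym (ℤP.*-identityʳ (b * b))) (square-pos b<0)) (*-nonneg (ℤP.<⇒≤ S>0) T≥0))))
    where
    p = 𝔽 (suc j)
    q = 𝔽 j
    S = a * q + b * p
    T = a * q + (- b) * (p - q)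
    q≥0 : 0ℤ ≤ q
    q≥0 = +≤+ z≤n
    T≥0 : 0ℤ ≤ T
    T≥0 = ℤP.+-mono-≤ (*-nonneg (ℤP.<⇒≤ a>0) q≥0)
                      (*-nonneg (ℤP.neg-mono-≤ (ℤP.<⇒≤ b<0)) (ℤP.i≤j⇒0≤j-i (+≤+ (F-mono j))))
    identity : ∀ a b p q → q * q * (a * a + a * b - b * b)
             ≡ b * b * (p * p - p * q - q * q) + (a * q + b * p) * (a * q + (- b) * (p - q))
    identity = solve-∀

  norm-neg : ∀ {a b} j → a < 0ℤ → 0ℤ < b → 0ℤ < fibComb a b j → cassini j ≡ - 1ℤ → norm a b < 0ℤ
  norm-neg {a} {b} j a<0 b>0 S>0 C≡-1 = ℤP.neg-cancel-< (*-cancel-pos (*-nonneg q≥0 q≥0)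
    (subst (0ℤ <_) (sym (identity a b p q))
      (subst (λ c → 0ℤ < b * b * - c + S * T) (sym C≡-1)
        (ℤP.+-mono-<-≤ (subst (0ℤ <_) (sym (ℤP.*-identityʳ (b * b))) (*-pos b>0 b>0)) (*-nonneg (ℤP.<⇒≤ S>0) T≥0)))))
    where
    p = 𝔽 (suc j)
    q = 𝔽 j
    S = a * q + b * p
    T = (- a) * q + b * (p - q)
    q≥0 : 0ℤ ≤ q
    q≥0 = +≤+ z≤n
    T≥0 : 0ℤ ≤ T
    T≥0 = ℤP.+-mono-≤ (*-nonneg (ℤP.neg-mono-≤ (ℤP.<⇒≤ a<0)) q≥0)
                      (*-nonneg (ℤP.<⇒≤ b>0) (ℤP.i≤j⇒0≤j-i (+≤+ (F-mono j))))
    identity : ∀ a b p q → q * q * - (a * a + a * b - b * b)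
             ≡ b * b * - (p * p - p * q - q * q) + (a * q + b * p) * ((- a) * q + b * (p - q))
    identity = solve-∀

  fibComb-nonpos : ∀ {a b} n → a ≤ 0ℤ → b ≤ 0ℤ → ¬ (0ℤ < fibComb a b n)
  fibComb-nonpos {a} {b} n a≤0 b≤0 S>0 = ℤP.<⇒≱ S>0 (ℤP.neg-cancel-≤
    (subst (0ℤ ≤_) (negate a b (𝔽 n) (𝔽 (suc n)))
      (ℤP.+-mono-≤ (*-nonneg (ℤP.neg-mono-≤ a≤0) (+≤+ z≤n)) (*-nonneg (ℤP.neg-mono-≤ b≤0) (+≤+ z≤n)))))
    where
    negate : ∀ a b q p → (- a) * q + (- b) * p ≡ - (a * q + b * p)
    negate = solve-∀

  fibComb-with-cassini : ∀ {a b} n c → c ≡ 1ℤ ⊎ c ≡ - 1ℤ → 0ℤ < fibComb a b n → 0ℤ < fibComb a b (suc n)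
                       → ∃ λ j → 0ℤ < fibComb a b j × cassini j ≡ c
  fibComb-with-cassini n c c≡±1 S>0 S′>0 with cassini-±1 n | c≡±1
  ... | inj₁ (C≡1 , _) | inj₁ refl = n , S>0 , C≡1
  ... | inj₁ (_ , C′≡-1) | inj₂ refl = suc n , S′>0 , C′≡-1
  ... | inj₂ (_ , C′≡1) | inj₁ refl = suc n , S′>0 , C′≡1
  ... | inj₂ (C≡-1 , _) | inj₂ refl = n , S>0 , C≡-1

  -- (a + a + b) + b√5 = 2 (a + bφ), and its square-test (a + a + b)² − 5b² is 4 norm a b
  fibComb⇒Pos√5 : ∀ {a b} n → 0ℤ < fibComb a b n → 0ℤ < fibComb a b (suc n) → Pos√5 (a + a + b) b
  fibComb⇒Pos√5 {a} {b} n S>0 S′>0 with ℤP.<-cmp 0ℤ b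
  ... | tri< b>0 _ _ with 0ℤ ℤP.≤? a + a + b
  ...   | yes X≥0 = inj₂ (inj₁ (X≥0 , b>0))
  ...   | no X≱0 = inj₂ (inj₂ (inj₂ (X<0 , b>0 , 0<-⇒< (subst (0ℤ <_) (sym (norm-√5 a b)) 0<4norm))))
    where
    X<0 : a + a + b < 0ℤ
    X<0 = ℤP.≰⇒> X≱0
    a<0 : a < 0ℤ
    a<0 = ℤP.≰⇒> (λ a≥0 → X≱0 (ℤP.<⇒≤ (ℤP.+-mono-≤-< (ℤP.+-mono-≤ a≥0 a≥0) b>0)))
    norm<0 : norm a b < 0ℤ
    norm<0 with fibComb-with-cassini {a} {b} n (- 1ℤ) (inj₂ refl) S>0 S′>0
    ... | j , S>0 , C≡-1 = norm-neg j a<0 b>0 S>0 C≡-1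
    0<4norm : 0ℤ < + 4 * - norm a b
    0<4norm = *-pos {+ 4} (+<+ (s≤s z≤n)) (ℤP.neg-mono-< norm<0)
    norm-√5 : ∀ a b → + 5 * (b * b) - (a + a + b) * (a + a + b) ≡ + 4 * - (a * a + a * b - b * b)
    norm-√5 = solve-∀
  fibComb⇒Pos√5 {a} {b} n S>0 S′>0 | tri≈ _ refl _ =
    inj₁ (ℤP.+-mono-<-≤ (ℤP.+-mono-< a>0 a>0) ℤP.≤-refl , ℤP.≤-refl)
    where
    a>0 : 0ℤ < a
    a>0 = ℤP.≰⇒> (λ a≤0 → fibComb-nonpos {a} {b} n a≤0 ℤP.≤-refl S>0)
  fibComb⇒Pos√5 {a} {b} n S>0 S′>0 | tri> _ _ b<0 =
    inj₂ (inj₂ (inj₁ (X>0 , b<0 , 0<-⇒< (subst (0ℤ <_) (sym (norm-√5 a b)) 0<4norm))))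
    where
    a>0 : 0ℤ < a
    a>0 = ℤP.≰⇒> (λ a≤0 → fibComb-nonpos {a} {b} n a≤0 (ℤP.<⇒≤ b<0) S>0)
    norm>0 : 0ℤ < norm a b
    norm>0 with fibComb-with-cassini {a} {b} n 1ℤ (inj₁ refl) S>0 S′>0
    ... | j , S>0 , C≡1 = norm-pos j a>0 b<0 S>0 C≡1
    0<4norm : 0ℤ < + 4 * norm a b
    0<4norm = *-pos {+ 4} (+<+ (s≤s z≤n)) norm>0
    split : ∀ a b → a * (a + b) ≡ (a * a + a * b - b * b) + b * b
    split = solve-∀
    X>0 : 0ℤ < a + a + b
    X>0 = subst (0ℤ <_) (sym (ℤP.+-assoc a a b)) (ℤP.+-mono-< a>0 (*-cancel-pos (ℤP.<⇒≤ a>0)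
            (subst (0ℤ <_) (sym (split a b)) (ℤP.+-mono-<-≤ norm>0 (ℤP.<⇒≤ (square-pos b<0))))))
    norm-√5 : ∀ a b → (a + a + b) * (a + a + b) - + 5 * (b * b) ≡ + 4 * (a * a + a * b - b * b)
    norm-√5 = solve-∀

  Pos√5⇒0<⊎0< : ∀ {x y} → Pos√5 x y → 0ℤ < x ⊎ 0ℤ < y
  Pos√5⇒0<⊎0< (inj₁ (x>0 , _)) = inj₁ x>0
  Pos√5⇒0<⊎0< (inj₂ (inj₁ (_ , y>0))) = inj₂ y>0
  Pos√5⇒0<⊎0< (inj₂ (inj₂ (inj₁ (x>0 , _)))) = inj₁ x>0
  Pos√5⇒0<⊎0< (inj₂ (inj₂ (inj₂ (_ , y>0 , _)))) = inj₂ y>0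

  Pos√5-x<0 : ∀ {x y} → Pos√5 x y → x < 0ℤ → x * x < + 5 * (y * y)
  Pos√5-x<0 (inj₁ (x>0 , _)) x<0 = ⊥-elim (ℤP.<-asym x>0 x<0)
  Pos√5-x<0 (inj₂ (inj₁ (x≥0 , _))) x<0 = ⊥-elim (ℤP.<⇒≱ x<0 x≥0)
  Pos√5-x<0 (inj₂ (inj₂ (inj₁ (x>0 , _)))) x<0 = ⊥-elim (ℤP.<-asym x>0 x<0)
  Pos√5-x<0 (inj₂ (inj₂ (inj₂ (_ , _ , x²<5y²)))) _ = x²<5y²

  Pos√5-y<0 : ∀ {x y} → Pos√5 x y → y < 0ℤ → + 5 * (y * y) < x * x
  Pos√5-y<0 (inj₁ (_ , y≥0)) y<0 = ⊥-elim (ℤP.<⇒≱ y<0 y≥0)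
  Pos√5-y<0 (inj₂ (inj₁ (_ , y>0))) y<0 = ⊥-elim (ℤP.<-asym y>0 y<0)
  Pos√5-y<0 (inj₂ (inj₂ (inj₁ (_ , _ , 5y²<x²)))) _ = 5y²<x²
  Pos√5-y<0 (inj₂ (inj₂ (inj₂ (_ , y>0 , _)))) y<0 = ⊥-elim (ℤP.<-asym y>0 y<0)

  Pos√5-asym : ∀ {x y} → Pos√5 x y → Pos√5 (- x) (- y) → ⊥
  Pos√5-asym {x} {y} p q with Pos√5⇒0<⊎0< p | Pos√5⇒0<⊎0< q
  ... | inj₁ x>0 | inj₁ -x>0 = ℤP.<-asym x>0 (ℤP.neg-cancel-< -x>0)
  ... | inj₂ y>0 | inj₂ -y>0 = ℤP.<-asym y>0 (ℤP.neg-cancel-< -y>0)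
  ... | inj₁ x>0 | inj₂ -y>0 = ℤP.<-asym (Pos√5-y<0 p (ℤP.neg-cancel-< -y>0))
    (subst₂ _<_ (neg² x) (cong (+ 5 *_) (neg² y)) (Pos√5-x<0 q (ℤP.neg-mono-< x>0)))
    where
    neg² : ∀ x → (- x) * (- x) ≡ x * x
    neg² = solve-∀
  ... | inj₂ y>0 | inj₁ -x>0 = ℤP.<-asym (Pos√5-x<0 p (ℤP.neg-cancel-< -x>0))
    (subst₂ _<_ (cong (+ 5 *_) (neg² y)) (neg² x) (Pos√5-y<0 q (ℤP.neg-mono-< y>0)))
    where
    neg² : ∀ x → (- x) * (- x) ≡ x * x
    neg² = solve-∀

  Pos-asym : ∀ {x} → Pos x → Pos (negφ x) → ⊥
  Pos-asym {mk a b} p q = Pos√5-asym p (subst (λ c → Pos√5 c (- b)) (negate a b) q)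
    where
    negate : ∀ a b → - a + - a + - b ≡ - (a + a + b)
    negate = solve-∀

  ¬Pos-0φ : ¬ Pos 0φ
  ¬Pos-0φ p with Pos√5⇒0<⊎0< p
  ... | inj₁ 0<0 = ℤP.<-irrefl refl 0<0
  ... | inj₂ 0<0 = ℤP.<-irrefl refl 0<0

  Positive⇒Pos : ∀ {x} → Positive x → Pos x
  Positive⇒Pos {mk a b} p = from-fibComb (Positive⇒fibComb {a} {b} p)
    where
    from-fibComb : (∃ λ n → 0ℤ < fibComb a b n × 0ℤ < fibComb a b (suc n)) → Pos (mk a b)
    from-fibComb (n , S>0 , S′>0) = fibComb⇒Pos√5 {a} {b} n S>0 S′>0

  Pos⇒Positive : ∀ {x} → Pos x → Positive x
  Pos⇒Positive {x} px = classify (trichotomy x)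
    where
    classify : Trichotomous x → Positive x
    classify (inj₁ p) = p
    classify (inj₂ (inj₁ x≡0)) = ⊥-elim (¬Pos-0φ (subst Pos x≡0 px))
    classify (inj₂ (inj₂ p)) = ⊥-elim (Pos-asym {x} px (Positive⇒Pos {negφ x} p))

module HofstadterWindow where

  open import Data.Integer
    using (ℤ; ∣_∣; _%ℕ_; _/ℕ_; +_; +[1+_]; -_; _+_; _-_; _*_; _<_; _≤_; 0ℤ; 1ℤ; +<+; +≤+)
  import Data.Integer.Properties as ℤP
  open import Data.Integer.Tactic.RingSolver using (solve-∀)
  import Data.Integer.DivMod as ℤD
  open import Data.Integer.Divisibility.Signed
    using (_∣_; divides; ∣-refl; ∣m∣n⇒∣m+n; ∣m∣n⇒∣m-n; ∣m⇒∣m*n; ∣n⇒∣m*n; ∣⇒∣ᵤ)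
  import Data.Nat.Divisibility as ℕD
  import Data.Nat.DivMod as ND
  open import Data.Nat using (_%_)
  import Tactic.RingSolver as RingSolver
  open ℤ[φ]

  err : ℤ → ℤ → ℤφ
  err u v = fromℤ v -φ fromℤ u *φ φ

  -- (u, v) is a G pair iff −1 < err u v < φ⁻¹
  InGWindow : ℤφ → Set
  InGWindow e = Positive (e +φ 1φ) × Positive (φ⁻¹ -φ e)

  window-step : ∀ {e p n} → InGWindow e → Positive p → Positive (negφ n) → Positive (φ -φ (p -φ n))
              → InGWindow (e -φ p) ⊎ InGWindow (e -φ n)
  window-step {e} {p} {n} (lo , hi) p>0 n<0 narrow = choose (trichotomy (e -φ p +φ 1φ))
    where
    lower : ∀ e p → φ⁻¹ -φ e +φ p ≡ φ⁻¹ -φ (e -φ p)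
    lower = RingSolver.solve-∀ ℤφ-ring
    upper : ∀ e n → e +φ 1φ +φ negφ n ≡ e -φ n +φ 1φ
    upper = RingSolver.solve-∀ ℤφ-ring
    across : ∀ f e p n → f -φ (p -φ n) +φ negφ (e -φ p +φ 1φ) ≡ (f -φ 1φ) -φ (e -φ n)
    across = RingSolver.solve-∀ ℤφ-ring
    nonneg : ∀ {x} → x ≡ 0φ ⊎ Positive (negφ x) → NonNegative (negφ x)
    nonneg (inj₁ refl) = inj₂ refl
    nonneg (inj₂ p) = inj₁ p
    -- either e − p stays above −1, or e − n = (e − p) + (p − n) lands below −1 + φ = φ⁻¹
    choose : Trichotomous (e -φ p +φ 1φ) → InGWindow (e -φ p) ⊎ InGWindow (e -φ n)
    choose (inj₁ lo′) = inj₁ (lo′ , subst Positive (lower e p) (Positive-+ hi p>0))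
    choose (inj₂ below) = inj₂ (subst Positive (upper e n) (Positive-+ lo n<0) ,
      subst Positive (across φ e p n) (Positive-+-NonNegative narrow (nonneg below)))

  difference-in-window : ∀ {x y c} → NonNegative x → NonNegative (c -φ x) → NonNegative y → NonNegative (c -φ y)
                       → Positive (φ⁻¹ -φ c) → InGWindow (x -φ y)
  difference-in-window {x} {y} {c} x≥0 x≤c y≥0 y≤c c<φ⁻¹ =
    subst Positive (lower x y c φ⁻¹)
      (Positive-+-NonNegative (Positive-+ Positive-1-φ⁻¹ c<φ⁻¹) (NonNegative-+ y≤c x≥0)) ,
    subst Positive (upper x y c φ⁻¹) (Positive-+-NonNegative c<φ⁻¹ (NonNegative-+ x≤c y≥0))
    where
    lower : ∀ x y c e → (1φ -φ e) +φ (e -φ c) +φ ((c -φ y) +φ x) ≡ x -φ y +φ 1φ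
    lower = RingSolver.solve-∀ ℤφ-ring
    upper : ∀ x y c e → (e -φ c) +φ ((c -φ x) +φ y) ≡ e -φ (x -φ y)
    upper = RingSolver.solve-∀ ℤφ-ring

  ι-suc : ∀ n → ι (suc n) ≡ ι n +φ 1φ
  ι-suc n = mk-≡ (trans (cong +_ (ℕP.+-comm 1 n)) (ℤP.pos-+ n 1)) refl

  IsG-from-window : ∀ u v → InGWindow (err (+ u) (+ v)) → IsG u v
  IsG-from-window u v (lo , hi) =
    (λ above → Positive-asym lo (subst Positive below≡ (Pos⇒Positive {ι u *φ φ -φ ι (suc v)} above))) ,
    Positive⇒Pos {ι (suc u) *φ φ -φ ι (suc v)} (subst Positive above≡ hi)
    where
    flip : ∀ U V f → U *φ f -φ (V +φ 1φ) ≡ negφ (V -φ U *φ f +φ 1φ)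
    flip = RingSolver.solve-∀ ℤφ-ring
    shift : ∀ U V f → (f -φ 1φ) -φ (V -φ U *φ f) ≡ (U +φ 1φ) *φ f -φ (V +φ 1φ)
    shift = RingSolver.solve-∀ ℤφ-ring
    below≡ : ι u *φ φ -φ ι (suc v) ≡ negφ (err (+ u) (+ v) +φ 1φ)
    below≡ = trans (cong (λ w → ι u *φ φ -φ w) (ι-suc v)) (flip (ι u) (ι v) φ)
    above≡ : φ⁻¹ -φ err (+ u) (+ v) ≡ ι (suc u) *φ φ -φ ι (suc v)
    above≡ = trans (shift (ι u) (ι v) φ) (cong₂ (λ w z → w *φ φ -φ z) (sym (ι-suc u)) (sym (ι-suc v)))

  window⇒0<u : ∀ {u v} → 0ℤ < v → InGWindow (err u v) → 0ℤ < u
  window⇒0<u {u} {v} v>0 (_ , hi) = ℤP.≰⇒> λ u≤0 → Positive-asym hi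
    (subst Positive (regroup (fromℤ u) (fromℤ v) φ) (Positive-+-NonNegative Positive-1-φ⁻¹
      (NonNegative-+ (NonNegative-ℤ (ℤP.i≤j⇒0≤j-i (ℤP.i<j⇒suc[i]≤j v>0)))
                     (NonNegative-ℤ* (ℤP.neg-mono-≤ u≤0) Positive-φ))))
    where
    regroup : ∀ U V f → (1φ -φ (f -φ 1φ)) +φ ((V -φ 1φ) +φ negφ U *φ f) ≡ negφ ((f -φ 1φ) -φ (V -φ U *φ f))
    regroup = RingSolver.solve-∀ ℤφ-ring

  <⇒0<- : ∀ {i j} → i < j → 0ℤ < j - i
  <⇒0<- {i} {j} i<j = subst (_< j - i) (ℤP.+-inverseʳ i) (ℤP.+-monoˡ-< (- i) i<j)

  descend : ∀ (P : ℤ → ℤ → Set) {a₁ b₁ a₂ b₂} → 0ℤ < b₁ → b₁ ≤ b₂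
          → (∀ {u v} → P u v → P (u - a₁) (v - b₁) ⊎ P (u - a₂) (v - b₂))
          → ∀ {u v} → P u v → 0ℤ < v → ∃ λ u′ → ∃ λ v′ → P u′ v′ × 0ℤ < v′ × v′ ≤ b₂
  descend P {a₁} {b₁} {a₂} {b₂} b₁>0 b₁≤b₂ move {u} {+ v} Puv v>0 = go v ℤP.≤-refl Puv v>0
    where
    Lowered : Set
    Lowered = ∃ λ u′ → ∃ λ v′ → P u′ v′ × 0ℤ < v′ × v′ ≤ b₂

    lower : ∀ {v b n} → v ≤ + suc n → 0ℤ < b → v - b ≤ + n
    lower v≤ b>0 = ℤP.+-mono-≤ v≤ (ℤP.neg-mono-≤ (ℤP.i<j⇒suc[i]≤j b>0))

    go : ∀ n {u v} → v ≤ + n → P u v → 0ℤ < v → Lowered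
    go n {u} {v} v≤n Puv v>0 with v ℤP.≤? b₂
    ... | yes v≤b₂ = u , v , Puv , v>0 , v≤b₂
    go zero {v = v} v≤0 _ v>0 | no _ = ⊥-elim (ℤP.<⇒≱ v>0 v≤0)
    go (suc n) {u} {v} v≤n Puv v>0 | no v≰b₂ = continue (move Puv)
      where
      b₂<v : b₂ < v
      b₂<v = ℤP.≰⇒> v≰b₂
      continue : P (u - a₁) (v - b₁) ⊎ P (u - a₂) (v - b₂) → Lowered
      continue (inj₁ P₁) = go n (lower v≤n b₁>0) P₁ (<⇒0<- (ℤP.≤-<-trans b₁≤b₂ b₂<v))
      continue (inj₂ P₂) = go n (lower v≤n (ℤP.<-≤-trans b₁>0 b₁≤b₂)) P₂ (<⇒0<- b₂<v)

  residue : ∀ R .{{_ : NonZero R}} z → ∃ λ m → m ℕ.< R × (+ R ∣ + m - z)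
  residue R z = z %ℕ R , ℤD.n%ℕd<d z R , divides (- (z /ℕ R)) (begin
    + (z %ℕ R) - z                              ≡⟨ cong (_-_ (+ (z %ℕ R))) (ℤD.a≡a%ℕn+[a/ℕn]*n z R) ⟩
    + (z %ℕ R) - (+ (z %ℕ R) + (z /ℕ R) * + R)  ≡⟨ cancel (+ (z %ℕ R)) (z /ℕ R) (+ R) ⟩
    - (z /ℕ R) * + R                            ∎)
    where
    open ≡-Reasoning
    cancel : ∀ m q r → m - (m + q * r) ≡ - q * r
    cancel = solve-∀

  ℤ-pos : ∀ R .{{_ : NonZero R}} → 0ℤ < + R
  ℤ-pos (suc _) = +<+ (s≤s z≤n)

  -- α = 1 + m rather than m keeps the point α (a, b) + β (c, d) off the origin
  unimodular-residues : ∀ R .{{_ : NonZero R}} a b c d S T → (a * d - b * c) * (a * d - b * c) ≡ 1ℤ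
    → ∃ λ m → ∃ λ n → m ℕ.< R × n ℕ.< R
      × (+ R ∣ +[1+ m ] * a + + n * c - S) × (+ R ∣ +[1+ m ] * b + + n * d - T)
  unimodular-residues R a b c d S T D²≡1 =
    combine (residue R ((a * d - b * c) * (d * S - c * T) - 1ℤ)) (residue R ((a * d - b * c) * (a * T - b * S)))
    where
    R∣D²-1 : + R ∣ (a * d - b * c) * (a * d - b * c) - 1ℤ
    R∣D²-1 = divides 0ℤ (cong (_- 1ℤ) D²≡1)
    -- α₀ = D (dS − cT) and β₀ = D (aT − bS), with D = ad − bc, solve the system exactly since D² = 1
    split-first : ∀ m n a b c d S T → (1ℤ + m) * a + n * c - S
      ≡ (m - ((a * d - b * c) * (d * S - c * T) - 1ℤ)) * a + (n - (a * d - b * c) * (a * T - b * S)) * c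
        + ((a * d - b * c) * (a * d - b * c) - 1ℤ) * S
    split-first = solve-∀
    split-second : ∀ m n a b c d S T → (1ℤ + m) * b + n * d - T
      ≡ (m - ((a * d - b * c) * (d * S - c * T) - 1ℤ)) * b + (n - (a * d - b * c) * (a * T - b * S)) * d
        + ((a * d - b * c) * (a * d - b * c) - 1ℤ) * T
    split-second = solve-∀
    combine : (∃ λ m → m ℕ.< R × (+ R ∣ + m - ((a * d - b * c) * (d * S - c * T) - 1ℤ)))
            → (∃ λ n → n ℕ.< R × (+ R ∣ + n - (a * d - b * c) * (a * T - b * S)))
            → ∃ λ m → ∃ λ n → m ℕ.< R × n ℕ.< R
              × (+ R ∣ +[1+ m ] * a + + n * c - S) × (+ R ∣ +[1+ m ] * b + + n * d - T)
    combine (m , m<R , R∣m) (n , n<R , R∣n) = m , n , m<R , n<R ,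
      subst (+ R ∣_) (sym (split-first (+ m) (+ n) a b c d S T))
        (∣m∣n⇒∣m+n (∣m∣n⇒∣m+n (∣m⇒∣m*n a R∣m) (∣m⇒∣m*n c R∣n)) (∣m⇒∣m*n S R∣D²-1)) ,
      subst (+ R ∣_) (sym (split-second (+ m) (+ n) a b c d S T))
        (∣m∣n⇒∣m+n (∣m∣n⇒∣m+n (∣m⇒∣m*n b R∣m) (∣m⇒∣m*n d R∣n)) (∣m⇒∣m*n T R∣D²-1))

  %-from-∣ : ∀ R .{{_ : NonZero R}} {U s} → s ℕ.< R → + R ∣ + U - + s → U % R ≡ s
  %-from-∣ R {U} {s} s<R R∣U-s with s ℕ.≤? U
  ... | yes s≤U = begin
    U % R               ≡⟨ cong (_% R) (sym (ℕP.m∸n+n≡m s≤U)) ⟩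
    (U ∸ s ℕ.+ s) % R   ≡⟨ ND.%-remove-+ˡ s R∣U∸s ⟩
    s % R               ≡⟨ ND.m<n⇒m%n≡m s<R ⟩
    s                   ∎
    where
    open ≡-Reasoning
    R∣U∸s : R ℕD.∣ U ∸ s
    R∣U∸s = subst (R ℕD.∣_) (trans (cong ∣_∣ (ℤP.m-n≡m⊖n U s)) (cong ∣_∣ (ℤP.⊖-≥ s≤U))) (∣⇒∣ᵤ R∣U-s)
  ... | no s≰U = ⊥-elim (ℕP.<⇒≱ s<R (ℕP.≤-trans R≤s∸U (ℕP.m∸n≤m s U)))
    where
    U<s = ℕP.≰⇒> s≰U
    R∣s∸U : R ℕD.∣ s ∸ U
    R∣s∸U = subst (R ℕD.∣_) (trans (cong ∣_∣ (ℤP.m-n≡m⊖n U s)) (ℤP.∣⊖∣-< U<s)) (∣⇒∣ᵤ R∣U-s)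
    R≤s∸U : R ℕ.≤ s ∸ U
    R≤s∸U = ℕD.∣⇒≤ {{ℕ.>-nonZero (ℕP.m<n⇒0<n∸m U<s)}} R∣s∸U

  err-combination : ∀ α β a b c d
                  → err (α * a + β * c) (α * b + β * d) ≡ fromℤ α *φ err a b +φ fromℤ β *φ err c d
  err-combination α β a b c d = begin
    fromℤ (α * b + β * d) -φ fromℤ (α * a + β * c) *φ φ
      ≡⟨ cong₂ (λ x y → x -φ y *φ φ) (cong₂ _+φ_ (fromℤ-* α b) (fromℤ-* β d))
                                      (cong₂ _+φ_ (fromℤ-* α a) (fromℤ-* β c)) ⟩
    A *φ fromℤ b +φ B *φ fromℤ d -φ (A *φ fromℤ a +φ B *φ fromℤ c) *φ φ
      ≡⟨ regroup A B (fromℤ a) (fromℤ b) (fromℤ c) (fromℤ d) φ ⟩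
    A *φ err a b +φ B *φ err c d ∎
    where
    open ≡-Reasoning
    A = fromℤ α
    B = fromℤ β
    regroup : ∀ A B a b c d f
            → A *φ b +φ B *φ d -φ (A *φ a +φ B *φ c) *φ f ≡ A *φ (b -φ a *φ f) +φ B *φ (d -φ c *φ f)
    regroup = RingSolver.solve-∀ ℤφ-ring

  err-shift : ∀ u v r a b → err (u - r * a) (v - r * b) ≡ err u v -φ fromℤ r *φ err a b
  err-shift u v r a b = begin
    fromℤ (v - r * b) -φ fromℤ (u - r * a) *φ φ
      ≡⟨ cong₂ (λ x y → fromℤ v -φ x -φ (fromℤ u -φ y) *φ φ) (fromℤ-* r b) (fromℤ-* r a) ⟩
    fromℤ v -φ fromℤ r *φ fromℤ b -φ (fromℤ u -φ fromℤ r *φ fromℤ a) *φ φ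
      ≡⟨ regroup (fromℤ u) (fromℤ v) (fromℤ r) (fromℤ a) (fromℤ b) φ ⟩
    err u v -φ fromℤ r *φ err a b ∎
    where
    open ≡-Reasoning
    regroup : ∀ U V r a b f → V -φ r *φ b -φ (U -φ r *φ a) *φ f ≡ V -φ U *φ f -φ r *φ (b -φ a *φ f)
    regroup = RingSolver.solve-∀ ℤφ-ring

  -- The two moves shift the error by R ψʰ and R ψʰ⁺¹, of opposite signs; their difference
  -- R φ⁻ʰ (1 + φ⁻¹) = φ R φ⁻ʰ is below the window width φ.
  gwindow-move : ∀ R h → 0ℤ < R → Positive (1φ -φ fromℤ R *φ φ⁻¹ ^φ h) → ∀ {u v} → InGWindow (err u v)
    → InGWindow (err (u - R * 𝔽 h) (v - R * 𝔽 (suc h)))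
    ⊎ InGWindow (err (u - R * 𝔽 (suc h)) (v - R * 𝔽 (suc (suc h))))
  gwindow-move R h R>0 small {u} {v} w =
    Sum.map (subst InGWindow (sym (shift h))) (subst InGWindow (sym (shift (suc h)))) (by-parity (ψ^-sign h))
    where
    e = err u v
    r = fromℤ R
    E = φ⁻¹ ^φ h
    E′ = φ⁻¹ ^φ suc h

    shift : ∀ k → err (u - R * 𝔽 k) (v - R * 𝔽 (suc k)) ≡ e -φ r *φ ψ ^φ k
    shift k = trans (err-shift u v R (𝔽 k) (𝔽 (suc k))) (cong (λ z → e -φ r *φ z) (sym (ψ^-𝔽 k)))

    rE>0 : ∀ k → Positive (r *φ φ⁻¹ ^φ k)
    rE>0 k = Positive-* (Positive-ℤ R>0) (Positive-φ⁻¹^ k)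

    widen : ∀ f r e → f *φ (1φ -φ r *φ e) ≡ f -φ (r *φ e +φ r *φ ((f -φ 1φ) *φ e))
    widen = RingSolver.solve-∀ ℤφ-ring
    narrow : Positive (φ -φ (r *φ E +φ r *φ E′))
    narrow = subst Positive (widen φ r E) (Positive-* Positive-φ small)

    neg-neg : ∀ r e → r *φ e ≡ negφ (r *φ negφ e)
    neg-neg = RingSolver.solve-∀ ℤφ-ring
    width₁ : ∀ f r e e′ → f -φ (r *φ e +φ r *φ e′) ≡ f -φ (r *φ e -φ r *φ negφ e′)
    width₁ = RingSolver.solve-∀ ℤφ-ring
    width₂ : ∀ f r e e′ → f -φ (r *φ e +φ r *φ e′) ≡ f -φ (r *φ e′ -φ r *φ negφ e)
    width₂ = RingSolver.solve-∀ ℤφ-ring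

    Moved : ℤφ → ℤφ → Set
    Moved a b = InGWindow (e -φ r *φ a) ⊎ InGWindow (e -φ r *φ b)

    by-parity : (ψ ^φ h ≡ E × ψ ^φ suc h ≡ negφ E′) ⊎ (ψ ^φ h ≡ negφ E × ψ ^φ suc h ≡ E′)
              → Moved (ψ ^φ h) (ψ ^φ suc h)
    by-parity (inj₁ (ψʰ≡ , ψʰ⁺¹≡)) = subst₂ Moved (sym ψʰ≡) (sym ψʰ⁺¹≡)
      (window-step {e} {r *φ E} {r *φ negφ E′} w (rE>0 h) (subst Positive (neg-neg r E′) (rE>0 (suc h)))
        (subst Positive (width₁ φ r E E′) narrow))
    by-parity (inj₂ (ψʰ≡ , ψʰ⁺¹≡)) = subst₂ Moved (sym ψʰ≡) (sym ψʰ⁺¹≡)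
      (Sum.swap (window-step {e} {r *φ E′} {r *φ negφ E} w (rE>0 (suc h)) (subst Positive (neg-neg r E) (rE>0 h))
        (subst Positive (width₂ φ r E E′) narrow)))

  -- α (F (h+1), F (h+2)) + β (F (h+2), F (h+3)) has error α ψʰ⁺¹ + β ψʰ⁺², a difference of two
  -- numbers in [0, R φ⁻ʰ⁻¹], and R φ⁻ʰ⁻¹ < φ⁻¹.
  initial-point : ∀ R .{{_ : NonZero R}} h s t → Positive (1φ -φ ι R *φ φ⁻¹ ^φ h)
    → ∃ λ u → ∃ λ v → ((+ R ∣ u - s) × (+ R ∣ v - t) × InGWindow (err u v)) × 0ℤ < v
  initial-point R h s t small = from-residues (unimodular-residues R a b b d s t (det-𝔽² h))
    where
    a = 𝔽 (suc h)
    b = 𝔽 (suc (suc h))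
    d = 𝔽 (suc (suc (suc h)))
    A = φ⁻¹ ^φ suc h
    B = φ⁻¹ ^φ suc (suc h)
    r = ι R
    c = r *φ A

    shrink : ∀ e r E → e *φ (1φ -φ r *φ E) ≡ e -φ r *φ (e *φ E)
    shrink = RingSolver.solve-∀ ℤφ-ring
    factor : ∀ r x A → r *φ A -φ x *φ A ≡ (r -φ x) *φ A
    factor = RingSolver.solve-∀ ℤφ-ring
    split : ∀ r y A B → r *φ A -φ y *φ B ≡ (r -φ y) *φ B +φ r *φ (A -φ B)
    split = RingSolver.solve-∀ ℤφ-ring
    as-difference : ∀ x y A B → x *φ A +φ y *φ negφ B ≡ x *φ A -φ y *φ B
    as-difference = RingSolver.solve-∀ ℤφ-ring
    as-difference′ : ∀ x y A B → x *φ negφ A +φ y *φ B ≡ y *φ B -φ x *φ A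
    as-difference′ = RingSolver.solve-∀ ℤφ-ring

    c<φ⁻¹ : Positive (φ⁻¹ -φ c)
    c<φ⁻¹ = subst Positive (shrink φ⁻¹ r (φ⁻¹ ^φ h)) (Positive-* Positive-φ⁻¹ small)

    from-residues : (∃ λ m → ∃ λ n → m ℕ.< R × n ℕ.< R
                       × (+ R ∣ +[1+ m ] * a + + n * b - s) × (+ R ∣ +[1+ m ] * b + + n * d - t))
                  → ∃ λ u → ∃ λ v → ((+ R ∣ u - s) × (+ R ∣ v - t) × InGWindow (err u v)) × 0ℤ < v
    from-residues (m , n , m<R , n<R , R∣u , R∣v) =
      +[1+ m ] * a + + n * b , +[1+ m ] * b + + n * d ,
      (R∣u , R∣v , subst InGWindow (sym error) (by-parity (ψ^-sign (suc h)))) ,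
      ℤP.+-mono-<-≤ (*-pos {+[1+ m ]} {b} (+<+ (s≤s z≤n)) (+<+ (F-pos (suc h))))
                    (*-nonneg {+ n} {d} (+≤+ z≤n) (+≤+ z≤n))
      where
      α = fromℤ +[1+ m ]
      β = fromℤ (+ n)
      X = α *φ A
      Y = β *φ B
      X≥0 : NonNegative X
      X≥0 = NonNegative-ℤ* {+[1+ m ]} (+≤+ z≤n) (Positive-φ⁻¹^ (suc h))
      X≤c : NonNegative (c -φ X)
      X≤c = subst NonNegative (sym (factor r α A)) (NonNegative-ℤ* (ℤP.i≤j⇒0≤j-i (+≤+ m<R)) (Positive-φ⁻¹^ (suc h)))
      Y≥0 : NonNegative Y
      Y≥0 = NonNegative-ℤ* {+ n} (+≤+ z≤n) (Positive-φ⁻¹^ (suc (suc h)))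
      Y≤c : NonNegative (c -φ Y)
      Y≤c = subst NonNegative (sym (split r β A B))
        (NonNegative-+ (NonNegative-ℤ* (ℤP.i≤j⇒0≤j-i (+≤+ (ℕP.<⇒≤ n<R))) (Positive-φ⁻¹^ (suc (suc h))))
                       (inj₁ (Positive-* (Positive-ℤ (ℤ-pos R)) (φ⁻¹^-decreasing (suc h)))))

      error : err (+[1+ m ] * a + + n * b) (+[1+ m ] * b + + n * d) ≡ α *φ ψ ^φ suc h +φ β *φ ψ ^φ suc (suc h)
      error = trans (err-combination +[1+ m ] (+ n) a b b d)
                    (cong₂ (λ x y → α *φ x +φ β *φ y) (sym (ψ^-𝔽 (suc h))) (sym (ψ^-𝔽 (suc (suc h)))))
      by-parity : (ψ ^φ suc h ≡ A × ψ ^φ suc (suc h) ≡ negφ B) ⊎ (ψ ^φ suc h ≡ negφ A × ψ ^φ suc (suc h) ≡ B)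
                → InGWindow (α *φ ψ ^φ suc h +φ β *φ ψ ^φ suc (suc h))
      by-parity (inj₁ (ψ≡ , ψ′≡)) = subst₂ (λ p q → InGWindow (α *φ p +φ β *φ q)) (sym ψ≡) (sym ψ′≡)
        (subst InGWindow (sym (as-difference α β A B)) (difference-in-window {X} {Y} {c} X≥0 X≤c Y≥0 Y≤c c<φ⁻¹))
      by-parity (inj₂ (ψ≡ , ψ′≡)) = subst₂ (λ p q → InGWindow (α *φ p +φ β *φ q)) (sym ψ≡) (sym ψ′≡)
        (subst InGWindow (sym (as-difference′ α β A B)) (difference-in-window {Y} {X} {c} Y≥0 Y≤c X≥0 X≤c c<φ⁻¹))

  R<φʰ⇒Rφ⁻ʰ<1 : ∀ R h → Positive (φ ^φ h -φ fromℤ R) → Positive (1φ -φ fromℤ R *φ φ⁻¹ ^φ h)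
  R<φʰ⇒Rφ⁻ʰ<1 R h R<φʰ = subst Positive scaled (Positive-* (Positive-φ⁻¹^ h) R<φʰ)
    where
    expand : ∀ E P r → E *φ (P -φ r) ≡ E *φ P -φ r *φ E
    expand = RingSolver.solve-∀ ℤφ-ring
    scaled : φ⁻¹ ^φ h *φ (φ ^φ h -φ fromℤ R) ≡ 1φ -φ fromℤ R *φ φ⁻¹ ^φ h
    scaled = trans (expand (φ⁻¹ ^φ h) (φ ^φ h) (fromℤ R)) (cong (_-φ fromℤ R *φ φ⁻¹ ^φ h) (φ⁻¹^*φ^ h))

  -- When ψʰ < 0, φʰ = L + φ⁻ʰ with L = lucas h an integer and φ⁻ʰ ≤ 1, so R < φʰ forces R ≤ L.
  lucas-bound : ∀ R h → ψ ^φ h ≡ negφ (φ⁻¹ ^φ h) → Positive (φ ^φ h -φ fromℤ R) → R ≤ lucas h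
  lucas-bound R h ψʰ≡ R<φʰ = subst (R ≤_) (ℤP.pred-suc (lucas h)) (ℤP.i<j⇒i≤pred[j] (0<-⇒< {R} {1ℤ + lucas h}
    (Positive-ℤ⁻¹ {1ℤ + lucas h - R} (subst Positive lucas≡ (Positive-+-NonNegative R<φʰ (NonNegative-1-φ⁻¹^ h))))))
    where
    regroup : ∀ P E r → (P -φ r) +φ (1φ -φ E) ≡ 1φ +φ (P +φ negφ E) -φ r
    regroup = RingSolver.solve-∀ ℤφ-ring
    lucas≡ : (φ ^φ h -φ fromℤ R) +φ (1φ -φ φ⁻¹ ^φ h) ≡ fromℤ (1ℤ + lucas h - R)
    lucas≡ = begin
      (φ ^φ h -φ fromℤ R) +φ (1φ -φ φ⁻¹ ^φ h)        ≡⟨ regroup (φ ^φ h) (φ⁻¹ ^φ h) (fromℤ R) ⟩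
      1φ +φ (φ ^φ h +φ negφ (φ⁻¹ ^φ h)) -φ fromℤ R
        ≡⟨ cong (λ q → 1φ +φ (φ ^φ h +φ q) -φ fromℤ R) (sym ψʰ≡) ⟩
      1φ +φ (φ ^φ h +φ ψ ^φ h) -φ fromℤ R            ≡⟨ cong (λ L → 1φ +φ L -φ fromℤ R) (φ^+ψ^ h) ⟩
      fromℤ (1ℤ + lucas h - R)                        ∎
      where open ≡-Reasoning

  lucas-𝔽 : ∀ h → ψ ^φ h ≡ negφ (φ⁻¹ ^φ h) → lucas h * 𝔽 (suc (suc h)) < 𝔽 (h ℕ.+ suc (suc h))
  lucas-𝔽 h ψʰ≡ = 0<-⇒< {lucas h * 𝔽 (suc (suc h))} (Positive-ℤ⁻¹ (subst Positive (sym difference) positive))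
    where
    F₂ F₀ : ℤφ
    F₂ = fromℤ (𝔽 (suc (suc h)))
    F₀ = fromℤ (𝔽 h)
    E₀ = φ⁻¹ ^φ h
    E₂ = φ⁻¹ ^φ suc (suc h)

    telescope : ∀ a b c → (a -φ b) +φ (b -φ c) ≡ a -φ c
    telescope = RingSolver.solve-∀ ℤφ-ring
    E₀>E₂ : Positive (E₀ -φ E₂)
    E₀>E₂ = subst Positive (telescope E₀ (φ⁻¹ ^φ suc h) E₂)
                           (Positive-+ (φ⁻¹^-decreasing h) (φ⁻¹^-decreasing (suc h)))
    positive : Positive (F₂ *φ (E₀ -φ E₂) +φ (F₂ -φ F₀) *φ E₂)
    positive = Positive-+-NonNegative (Positive-* (Positive-ℤ (+<+ (F-pos (suc h)))) E₀>E₂)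
      (NonNegative-ℤ* (ℤP.i≤j⇒0≤j-i (+≤+ (ℕP.≤-trans (F-mono h) (F-mono (suc h))))) (Positive-φ⁻¹^ (suc (suc h))))

    regroup : ∀ F₂ F₀ P e E₀ → (F₂ *φ P +φ F₀ *φ (e *φ (e *φ negφ E₀))) -φ (P +φ negφ E₀) *φ F₂
                             ≡ F₂ *φ (E₀ -φ e *φ (e *φ E₀)) +φ (F₂ -φ F₀) *φ (e *φ (e *φ E₀))
    regroup = RingSolver.solve-∀ ℤφ-ring
    difference : fromℤ (𝔽 (h ℕ.+ suc (suc h)) - lucas h * 𝔽 (suc (suc h)))
               ≡ F₂ *φ (E₀ -φ E₂) +φ (F₂ -φ F₀) *φ E₂
    difference = begin
      fromℤ (𝔽 (h ℕ.+ suc (suc h)) - lucas h * 𝔽 (suc (suc h)))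
        ≡⟨ cong (fromℤ (𝔽 (h ℕ.+ suc (suc h))) -φ_) (fromℤ-* (lucas h) (𝔽 (suc (suc h)))) ⟩
      fromℤ (𝔽 (h ℕ.+ suc (suc h))) -φ fromℤ (lucas h) *φ F₂
        ≡⟨ cong₂ (λ x L → x -φ L *φ F₂) (𝔽-doubled h) (sym (φ^+ψ^ h)) ⟩
      (F₂ *φ φ ^φ h +φ F₀ *φ (φ⁻¹ *φ (φ⁻¹ *φ ψ ^φ h))) -φ (φ ^φ h +φ ψ ^φ h) *φ F₂
        ≡⟨ cong (λ q → (F₂ *φ φ ^φ h +φ F₀ *φ (φ⁻¹ *φ (φ⁻¹ *φ q))) -φ (φ ^φ h +φ q) *φ F₂) ψʰ≡ ⟩
      (F₂ *φ φ ^φ h +φ F₀ *φ (φ⁻¹ *φ (φ⁻¹ *φ negφ E₀))) -φ (φ ^φ h +φ negφ E₀) *φ F₂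
        ≡⟨ regroup F₂ F₀ (φ ^φ h) φ⁻¹ E₀ ⟩
      F₂ *φ (E₀ -φ E₂) +φ (F₂ -φ F₀) *φ E₂ ∎
      where open ≡-Reasoning

  -- F (2h+2) = F (h+2) φʰ + F h ψʰ⁺²: if ψʰ⁺² > 0 this exceeds R F (h+2) directly,
  -- otherwise R ≤ lucas h and lucas h F (h+2) < F (2h+2).
  golden-bound : ∀ R h → Positive (φ ^φ h -φ fromℤ R) → R * 𝔽 (suc (suc h)) < 𝔽 (h ℕ.+ suc (suc h))
  golden-bound R h R<φʰ = by-parity (ψ^-sign h)
    where
    F₂ F₀ : ℤφ
    F₂ = fromℤ (𝔽 (suc (suc h)))
    F₀ = fromℤ (𝔽 h)
    E₂ = φ⁻¹ ^φ suc (suc h)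

    positive : Positive (F₂ *φ (φ ^φ h -φ fromℤ R) +φ F₀ *φ E₂)
    positive = Positive-+-NonNegative (Positive-* (Positive-ℤ (+<+ (F-pos (suc h)))) R<φʰ)
                                      (NonNegative-ℤ* {𝔽 h} (+≤+ z≤n) (Positive-φ⁻¹^ (suc (suc h))))

    regroup : ∀ F₂ F₀ P r Q → (F₂ *φ P +φ F₀ *φ Q) -φ r *φ F₂ ≡ F₂ *φ (P -φ r) +φ F₀ *φ Q
    regroup = RingSolver.solve-∀ ℤφ-ring
    difference : ψ ^φ h ≡ φ⁻¹ ^φ h
               → fromℤ (𝔽 (h ℕ.+ suc (suc h)) - R * 𝔽 (suc (suc h)))
                 ≡ F₂ *φ (φ ^φ h -φ fromℤ R) +φ F₀ *φ E₂
    difference ψʰ≡ = begin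
      fromℤ (𝔽 (h ℕ.+ suc (suc h)) - R * 𝔽 (suc (suc h)))
        ≡⟨ cong (fromℤ (𝔽 (h ℕ.+ suc (suc h))) -φ_) (fromℤ-* R (𝔽 (suc (suc h)))) ⟩
      fromℤ (𝔽 (h ℕ.+ suc (suc h))) -φ fromℤ R *φ F₂
        ≡⟨ cong (_-φ fromℤ R *φ F₂)
             (trans (𝔽-doubled h) (cong (λ q → F₂ *φ φ ^φ h +φ F₀ *φ (φ⁻¹ *φ (φ⁻¹ *φ q))) ψʰ≡)) ⟩
      (F₂ *φ φ ^φ h +φ F₀ *φ E₂) -φ fromℤ R *φ F₂
        ≡⟨ regroup F₂ F₀ (φ ^φ h) (fromℤ R) E₂ ⟩
      F₂ *φ (φ ^φ h -φ fromℤ R) +φ F₀ *φ E₂ ∎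
      where open ≡-Reasoning

    by-parity : (ψ ^φ h ≡ φ⁻¹ ^φ h × ψ ^φ suc h ≡ negφ (φ⁻¹ ^φ suc h))
              ⊎ (ψ ^φ h ≡ negφ (φ⁻¹ ^φ h) × ψ ^φ suc h ≡ φ⁻¹ ^φ suc h)
              → R * 𝔽 (suc (suc h)) < 𝔽 (h ℕ.+ suc (suc h))
    by-parity (inj₁ (ψʰ≡ , _)) =
      0<-⇒< {R * 𝔽 (suc (suc h))} (Positive-ℤ⁻¹ (subst Positive (sym (difference ψʰ≡)) positive))
    by-parity (inj₂ (ψʰ≡ , _)) =
      ℤP.≤-<-trans (ℤP.*-monoʳ-≤-nonNeg (𝔽 (suc (suc h))) (lucas-bound R h ψʰ≡ R<φʰ)) (lucas-𝔽 h ψʰ≡)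

  G-pair-in-class : ∀ R .{{_ : NonZero R}} h s t → Positive (φ ^φ h -φ ι R)
    → ∃ λ u → ∃ λ v → ((+ R ∣ u - s) × (+ R ∣ v - t) × InGWindow (err u v))
                      × 0ℤ < u × 0ℤ < v × v ≤ + R * 𝔽 (suc (suc h))
  G-pair-in-class R h s t R<φʰ = finish (start (initial-point R h s t small))
    where
    small = R<φʰ⇒Rφ⁻ʰ<1 (+ R) h R<φʰ

    Class : ℤ → ℤ → Set
    Class u v = (+ R ∣ u - s) × (+ R ∣ v - t) × InGWindow (err u v)

    reorder : ∀ x y r c → x - y - c * r ≡ x - r * c - y
    reorder = solve-∀
    lower : ∀ x y c → + R ∣ x - y → + R ∣ x - + R * c - y
    lower x y c R∣x-y = subst (+ R ∣_) (reorder x y (+ R) c) (∣m∣n⇒∣m-n R∣x-y (∣n⇒∣m*n c ∣-refl))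

    move : ∀ {u v} → Class u v
         → Class (u - + R * 𝔽 h) (v - + R * 𝔽 (suc h)) ⊎ Class (u - + R * 𝔽 (suc h)) (v - + R * 𝔽 (suc (suc h)))
    move {u} {v} (R∣u , R∣v , w) =
      Sum.map (λ w′ → lower u s (𝔽 h) R∣u , lower v t (𝔽 (suc h)) R∣v , w′)
              (λ w′ → lower u s (𝔽 (suc h)) R∣u , lower v t (𝔽 (suc (suc h))) R∣v , w′)
              (gwindow-move (+ R) h (ℤ-pos R) small {u} {v} w)

    start : (∃ λ u → ∃ λ v → Class u v × 0ℤ < v)
          → ∃ λ u → ∃ λ v → Class u v × 0ℤ < v × v ≤ + R * 𝔽 (suc (suc h))
    start (u , v , c , v>0) =
      descend Class {+ R * 𝔽 h} {+ R * 𝔽 (suc h)} {+ R * 𝔽 (suc h)} {+ R * 𝔽 (suc (suc h))}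
        (*-pos {+ R} {𝔽 (suc h)} (ℤ-pos R) (+<+ (F-pos h))) (ℤP.*-monoˡ-≤-nonNeg (+ R) (+≤+ (F-mono (suc h))))
        (λ {u} {v} → move {u} {v}) {u} {v} c v>0

    finish : (∃ λ u → ∃ λ v → Class u v × 0ℤ < v × v ≤ + R * 𝔽 (suc (suc h)))
           → ∃ λ u → ∃ λ v → Class u v × 0ℤ < u × 0ℤ < v × v ≤ + R * 𝔽 (suc (suc h))
    finish (u , v , c , v>0 , v≤) = u , v , c , window⇒0<u v>0 (proj₂ (proj₂ c)) , v>0 , v≤

open import Data.Bool using (Bool; true; false)
open import Data.List using ([]; _∷_; _++_; length; replicate; last)
import Data.List.Properties as LP
open import Data.Maybe using (just)
open import Data.Unit using (tt)
import Data.Product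
open import Function using (case_of_)
open import Data.Nat using (_<_; _≤_; _*_; _%_)
open import Data.Nat.Tactic.RingSolver using () renaming (solve-∀ to ℕ-solve-∀)
open import Data.Integer using (+_; +<+)
import Data.Integer.Properties as ℤP
open ℤ[φ] using (_-φ_; Pos⇒Positive)
open HofstadterWindow using (G-pair-in-class; IsG-from-window; %-from-∣; golden-bound)

fibSumFrom-++ : ∀ j xs ys → fibSumFrom j (xs ++ ys) ≡ fibSumFrom j xs ℕ.+ fibSumFrom (length xs ℕ.+ j) ys
fibSumFrom-++ j [] ys = refl
fibSumFrom-++ j (true ∷ xs) ys = trans (cong (F j ℕ.+_) (shifted j xs ys)) (sym (ℕP.+-assoc (F j) _ _))
  where
  shifted : ∀ j xs ys → fibSumFrom (suc j) (xs ++ ys) ≡ fibSumFrom (suc j) xs ℕ.+ fibSumFrom (suc (length xs ℕ.+ j)) ys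
  shifted j xs ys = trans (fibSumFrom-++ (suc j) xs ys)
                          (cong (λ i → fibSumFrom (suc j) xs ℕ.+ fibSumFrom i ys) (ℕP.+-suc (length xs) j))
fibSumFrom-++ j (false ∷ xs) ys =
  trans (fibSumFrom-++ (suc j) xs ys) (cong (λ i → fibSumFrom (suc j) xs ℕ.+ fibSumFrom i ys) (ℕP.+-suc (length xs) j))

fibSumFrom-zeros : ∀ n j ys → fibSumFrom j (replicate n false ++ ys) ≡ fibSumFrom (n ℕ.+ j) ys
fibSumFrom-zeros zero j ys = refl
fibSumFrom-zeros (suc n) j ys = trans (fibSumFrom-zeros n (suc j) ys) (cong (λ i → fibSumFrom i ys) (ℕP.+-suc n j))

last-∷ʳ : ∀ xs (y : Bool) → last (xs ++ y ∷ []) ≡ just y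
last-∷ʳ [] y = refl
last-∷ʳ (x ∷ []) y = refl
last-∷ʳ (x ∷ x′ ∷ xs) y = last-∷ʳ (x′ ∷ xs) y

NoConsecutiveOnes-++ : ∀ xs ys → NoConsecutiveOnes xs → NoConsecutiveOnes (false ∷ ys)
                     → NoConsecutiveOnes (xs ++ false ∷ ys)
NoConsecutiveOnes-++ [] ys _ nc = nc
NoConsecutiveOnes-++ (true ∷ []) ys _ nc = nc
NoConsecutiveOnes-++ (false ∷ []) ys _ nc = nc
NoConsecutiveOnes-++ (true ∷ false ∷ xs) ys nc nc′ = NoConsecutiveOnes-++ (false ∷ xs) ys nc nc′
NoConsecutiveOnes-++ (false ∷ x ∷ xs) ys nc nc′ = NoConsecutiveOnes-++ (x ∷ xs) ys nc nc′

NoConsecutiveOnes-zeros-one : ∀ n → NoConsecutiveOnes (replicate n false ++ true ∷ [])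
NoConsecutiveOnes-zeros-one zero = tt
NoConsecutiveOnes-zeros-one (suc zero) = tt
NoConsecutiveOnes-zeros-one (suc (suc n)) = NoConsecutiveOnes-zeros-one (suc n)

add-leading-term : ∀ k w β → FibSum β ≡ w → NoConsecutiveOnes β → length β ≤ k
  → ∃ λ β′ → IsZeckendorf β′ (w ℕ.+ F (suc (suc (suc k)))) × length β′ ≤ suc (suc k)
add-leading-term k w β Σβ≡w nc len≤k =
  β ++ zeros++one , (sum , last≡ , NoConsecutiveOnes-++ β _ nc (NoConsecutiveOnes-zeros-one (suc n))) ,
  ℕP.≤-reflexive len
  where
  n = k ∸ length β
  zeros++one = replicate (suc n) false ++ true ∷ []
  k≡ : n ℕ.+ length β ≡ k
  k≡ = ℕP.m∸n+n≡m len≤k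
  index : suc n ℕ.+ (length β ℕ.+ 2) ≡ suc (suc (suc k))
  index = cong suc (trans (sym (ℕP.+-assoc n (length β) 2)) (trans (cong (ℕ._+ 2) k≡) (ℕP.+-comm k 2)))
  sum : FibSum (β ++ zeros++one) ≡ w ℕ.+ F (suc (suc (suc k)))
  sum = begin
    FibSum (β ++ zeros++one)
      ≡⟨ fibSumFrom-++ 2 β zeros++one ⟩
    FibSum β ℕ.+ fibSumFrom (length β ℕ.+ 2) zeros++one
      ≡⟨ cong₂ ℕ._+_ Σβ≡w (fibSumFrom-zeros (suc n) (length β ℕ.+ 2) (true ∷ [])) ⟩
    w ℕ.+ (F (suc n ℕ.+ (length β ℕ.+ 2)) ℕ.+ 0)
      ≡⟨ cong (w ℕ.+_) (trans (ℕP.+-identityʳ _) (cong F index)) ⟩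
    w ℕ.+ F (suc (suc (suc k))) ∎
    where open ≡-Reasoning
  last≡ : last (β ++ zeros++one) ≡ just true
  last≡ = trans (cong last (sym (LP.++-assoc β (replicate (suc n) false) (true ∷ []))))
                (last-∷ʳ (β ++ replicate (suc n) false) true)
  len : length (β ++ zeros++one) ≡ suc (suc k)
  len = begin
    length (β ++ zeros++one)      ≡⟨ LP.length-++ β ⟩
    length β ℕ.+ length zeros++one ≡⟨ cong (length β ℕ.+_) (trans (LP.length-++ (replicate (suc n) false))
                                                                 (cong (ℕ._+ 1) (LP.length-replicate (suc n)))) ⟩
    length β ℕ.+ (suc n ℕ.+ 1)    ≡⟨ cong (length β ℕ.+_) (ℕP.+-comm (suc n) 1) ⟩
    length β ℕ.+ suc (suc n)      ≡⟨ ℕP.+-comm (length β) (suc (suc n)) ⟩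
    suc (suc (n ℕ.+ length β))    ≡⟨ cong (λ i → suc (suc i)) k≡ ⟩
    suc (suc k)                   ∎
    where open ≡-Reasoning

ZeckendorfBelow : ℕ → Set
ZeckendorfBelow k = ∀ v → 0 < v → v < F (suc (suc k)) → ∃ λ β → IsZeckendorf β v × length β ≤ k

-- greedy: take the term F (k+3) whenever v ≥ F (k+3); the remainder is then below F (k+2)
zeckendorf-step : ∀ k → ZeckendorfBelow (suc k) → ZeckendorfBelow k → ZeckendorfBelow (suc (suc k))
zeckendorf-step k below₁ below₀ v 0<v v<F with v ℕ.<? F (suc (suc (suc k)))
... | yes v<F′ = Data.Product.map₂ (Data.Product.map₂ ℕP.m≤n⇒m≤1+n) (below₁ v 0<v v<F′)
... | no v≮F′ = subst (λ x → ∃ λ β → IsZeckendorf β x × length β ≤ suc (suc k))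
                     (ℕP.m∸n+n≡m (ℕP.≮⇒≥ v≮F′)) (with-leading-term (v ∸ F (suc (suc (suc k)))) w<F)
  where
  w<F : v ∸ F (suc (suc (suc k))) < F (suc (suc k))
  w<F = ℕP.+-cancelʳ-< _ _ _ (subst (_< F (suc (suc k)) ℕ.+ F (suc (suc (suc k)))) (sym (ℕP.m∸n+n≡m (ℕP.≮⇒≥ v≮F′)))
          (subst (v <_) (ℕP.+-comm (F (suc (suc (suc k)))) (F (suc (suc k)))) v<F))
  with-leading-term : ∀ w → w < F (suc (suc k))
                    → ∃ λ β → IsZeckendorf β (w ℕ.+ F (suc (suc (suc k)))) × length β ≤ suc (suc k)
  with-leading-term zero _ = add-leading-term k 0 [] refl tt z≤n
  with-leading-term (suc w) w<F with below₀ (suc w) (s≤s z≤n) w<F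
  ... | β , (Σβ≡w , _ , nc) , len = add-leading-term k (suc w) β Σβ≡w nc len

zeckendorf : ∀ k → ZeckendorfBelow k
zeckendorf zero (suc v) _ (s≤s ())
zeckendorf (suc zero) (suc zero) _ _ = true ∷ [] , (refl , refl , tt) , s≤s z≤n
zeckendorf (suc zero) (suc (suc v)) _ (s≤s (s≤s ()))
zeckendorf (suc (suc k)) = zeckendorf-step k (zeckendorf (suc k)) (zeckendorf k)

corollary2 : (r : ℕ) → .{{_ : NonZero r}} → (s t : ℕ) → s < r → t < r
  → (h : ℕ) → 0 < h → ι r <φ φ ^φ h
  → Σ ℕ λ u → Σ ℕ λ v → HofstadterGPair u v × u % r ≡ s × v % r ≡ t
    × Σ _ λ β → IsZeckendorf β v × length β ≤ 2 * h
corollary2 r s t s<r t<r h _ r<φʰ = case G-pair-in-class r h (+ s) (+ t) R<φʰ of λ where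
    (+ U , + V , (r∣U-s , r∣V-t , window) , +<+ U>0 , +<+ V>0 , V≤r𝔽) →
      U , V , (U>0 , V>0 , IsG-from-window U V window) , %-from-∣ r s<r r∣U-s , %-from-∣ r t<r r∣V-t ,
      zeckendorf (2 * h) V V>0 (subst (λ i → V < F i) (index h) (ℤP.drop‿+<+ (ℤP.≤-<-trans V≤r𝔽 r𝔽<𝔽)))
  where
  R<φʰ = Pos⇒Positive {φ ^φ h -φ ι r} r<φʰ
  r𝔽<𝔽 = golden-bound (+ r) h R<φʰ
  index : ∀ h → h ℕ.+ suc (suc h) ≡ suc (suc (2 * h))
  index = ℕ-solve-∀
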